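{- Let $\mathcal{C}$ be a clutter with vertex set $\{x_1,\dots,x_n\}$ that is totally balanced. Then $\Delta_{\mathcal{C}}$ is shellable.
   Context: A clutter on $X=\{x_1,\dots,x_n\}$ is a family of subsets of $X$ (edges $S_1,\dots,S_q$) none contained in another. Its incidence matrix is the $n\times q$ $0/1$ matrix whose $j$-th column is the characteristic vector of $S_j$. $\mathcal{C}$ is totally balanced if its incidence matrix has no square submatrix of order at least $3$ with exactly two $1$'s in each row and each column. $\Delta_{\mathcal{C}}$ is the Stanley–Reisner complex on $X$ of the edge ideal $I(\mathcal{C})=(\prod_{x\in S_j}x : j=1,\dots,q)\subset k[x_1,\dots,x_n]$; its facets are the complements of the minimal vertex covers. A simplicial complex is shellable if its facets can be ordered $F_1,\dots,F_s$ so that for all $1\le i<j\le s$ there exist $v\in F_j\setminus F_i$ and $\ell\in\{1,\dots,j-1\}$ with $F_j\setminus F_\ell=\{v\}$ (non-pure shellability). -}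

module Defs where

open import Data.Nat using (ℕ)
open import Data.Fin using (Fin; _<_)
open import Data.Fin.Subset using (Subset; _∈_; _⊆_; _∩_; _─_; ⁅_⁆; ∣_∣)
open import Data.Bool using (Bool; true; false)
open import Data.Vec using (tabulate)
open import Data.Product using (Σ; ∃; _×_)
open import Relation.Nullary using (¬_)
open import Relation.Binary.PropositionalEquality using (_≡_; _≢_)
open import Function.Definitions using (Injective)

Family : ℕ → ℕ → Set
Family n q = Fin q → Subset n

IsClutter : ∀ {n q} → Family n q → Set
IsClutter {n} {q} S = ∀ (i j : Fin q) → i ≢ j → ¬ (S i ⊆ S j)

incidence : ∀ {n q} → Family n q → Fin n → Fin q → Bool
incidence S x j = Data.Vec.lookup (S j) x
  where import Data.Vec

count1 : ∀ {k} → (Fin k → Bool) → ℕ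
count1 f = ∣ tabulate f ∣

TwoOnesSubmatrix : ∀ {n q} → Family n q → (k : ℕ) →
                   (Fin k → Fin n) → (Fin k → Fin q) → Set
TwoOnesSubmatrix S k r c =
  Injective _≡_ _≡_ r × Injective _≡_ _≡_ c ×
  (∀ a → count1 (λ b → incidence S (r a) (c b)) ≡ 2) ×
  (∀ b → count1 (λ a → incidence S (r a) (c b)) ≡ 2)

TotallyBalanced : ∀ {n q} → Family n q → Set
TotallyBalanced S = ∀ (k : ℕ) → 3 Data.Nat.≤ k →
  ∀ (r : Fin k → Fin _) (c : Fin k → Fin _) → ¬ TwoOnesSubmatrix S k r c
  where import Data.Nat

-- Stanley–Reisner complex Δ_C of the edge ideal I(C) = (x^{S_j}):
-- F is a face iff the squarefree monomial ∏_{x∈F} x is not in I(C),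
-- i.e. iff no edge S_j is contained in F.
IsFace : ∀ {n q} → Family n q → Subset n → Set
IsFace S F = ∀ j → ¬ (S j ⊆ F)

IsFacet : ∀ {n q} → Family n q → Subset n → Set
IsFacet S F = IsFace S F × (∀ G → IsFace S G → F ⊆ G → G ≡ F)

-- Non-pure shellability: an enumeration F_0,…,F_{s-1} of all facets
-- (without repetition) such that for all i < j there exist v ∈ F_j ∖ F_i
-- and ℓ < j with F_j ∖ F_ℓ = {v}.
IsShelling : ∀ {n q} → Family n q → (s : ℕ) → (Fin s → Subset n) → Set
IsShelling S s F =
  Injective _≡_ _≡_ F ×
  (∀ i → IsFacet S (F i)) ×
  (∀ G → IsFacet S G → ∃ λ i → F i ≡ G) ×
  (∀ (i j : Fin s) → i < j →
     ∃ λ v → (v ∈ F j ─ F i) ×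
       ∃ λ (ℓ : Fin s) → (ℓ < j) × (F j ─ F ℓ ≡ ⁅ v ⁆))

Shellable : ∀ {n q} → Family n q → Set
Shellable {n} S = Σ ℕ λ s → Σ (Fin s → Subset n) λ F → IsShelling S s F

-- A special cycle x₀ E₀ x₁ E₁ ⋯ x_L E_L x₀ (L ≥ 2), in which xₐ lies on E_b exactly when a ≡ b or
-- a ≡ b + 1 (mod L + 1), has an incidence submatrix with two ones in every row and column, so a
-- totally balanced family has none. The family is conformal:
-- vertices that pairwise share an edge all lie on one edge, since otherwise three of them form a
-- special triangle. And a walk that leaves an edge d and returns to it can be shortcut along chords
-- until it is a single edge, since a chordless one closed up by d is a special cycle. With these, an
-- induction on (|R| + |K|, |R ∖ d|) shows that for all vertex sets R, edge sets K and edges d not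
-- containing R there is a nest point x ∈ R ∖ d: the K-edges through x, traced on R, form a chain.
--
-- Shellability of Δ(W, E), whose faces are the subsets of W containing no edge, then follows by
-- induction on W. Let x be a nest point and e the smallest edge inside W through x. The facets
-- through x are {x} ∪ G for the facets G of the link Δ(W - x, E - x); the facets avoiding x all
-- contain A = E e - x and are A ∪ H for the facets H of Δ(W ∖ E e, E ∖ A). List the former first.
-- For X of the second kind and Y of the first, pick v ∈ E e ∖ Y: every facet Z containing
-- (X - v) ∪ {x} misses v, so X ∖ Z = {v}. Both smaller complexes inherit nest points.

module Submission where

open import Defs
open import Data.Bool using (Bool; true; false; if_then_else_)
open import Data.Bool.Properties using (¬-not)
open import Data.Empty using (⊥; ⊥-elim)
open import Data.Fin using (Fin; zero; suc; toℕ; fromℕ<; _↑ˡ_; _↑ʳ_; splitAt)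
import Data.Fin as Fin
open import Data.Fin.Properties
  using (_≟_; any?; all?; suc-injective; toℕ-injective; toℕ<n; toℕ-fromℕ<; fromℕ<-injective
        ; toℕ-↑ˡ; toℕ-↑ʳ; splitAt⁻¹-↑ˡ; splitAt⁻¹-↑ʳ)
open import Data.Fin.Subset
  using (Subset; inside; outside; ∁; ⊤; _∈_; _∉_; _⊆_; _⊂_; _∪_; _─_; _-_; ⁅_⁆; ∣_∣
        ; Nonempty; Empty)
  renaming (⊥ to ∅)
open import Data.Fin.Subset.Properties
open import Data.Maybe using (Maybe; nothing; just)
open import Data.Nat using (ℕ; zero; suc; _+_; _∸_; _≤_; _<_; z≤n; s≤s; s≤s⁻¹)
import Data.Nat as ℕ
open import Data.Nat.Induction using (<-wellFounded)
open import Data.Nat.Properties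
  using (≤-refl; ≤-trans; <-trans; ≤-<-trans; <-≤-trans; <⇒≤; <-irrefl; <-cmp; ≤-<-connex
        ; m≤n⇒m<n∨m≡n; ≤∧≢⇒<; 1+n≢n; m<n⇒m<1+n; m≤m+n; m<m+n; m<n⇒0<n∸m; m+[n∸m]≡n
        ; +-assoc; +-comm; +-monoˡ-<; +-monoʳ-<; +-mono-<-≤; +-mono-≤-<; +-cancelˡ-<)
open import Data.Product using (Σ; ∃; ∃₂; _×_; _,_; proj₁; proj₂)
open import Data.Product.Relation.Binary.Lex.Strict using (×-Lex; ×-wellFounded)
open import Data.Sum using (_⊎_; inj₁; inj₂)
import Data.Sum as Sum
open import Data.Vec using (Vec; _∷_; here; there; tabulate; lookup)
open import Data.Vec.Properties using ([]=⇒lookup; lookup⇒[]=; lookup∘tabulate)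
open import Data.Vec.Functional using (_++_)
open import Data.Vec.Functional.Properties using (lookup-++ˡ; lookup-++ʳ)
open import Function using (_∘_; id; case_of_; _on_)
open import Function.Definitions using (Injective)
open import Induction.WellFounded using (Acc; acc; WellFounded; module All)
import Relation.Binary.Construct.On as On
open import Relation.Binary.Definitions using (tri<; tri≈; tri>)
open import Relation.Binary.PropositionalEquality
open import Relation.Nullary using (Dec; yes; no; ¬_; ¬?)
open import Relation.Nullary.Decidable using (map′; _×-dec_; _⊎-dec_; does; dec-true; decidable-stable)

-- Finite sets

x∈p─q⇒x∉q : ∀ {n} {x : Fin n} {p q : Subset n} → x ∈ p ─ q → x ∉ q
x∈p─q⇒x∉q {x = zero}  {_ ∷ _} {outside ∷ _} _ ()
x∈p─q⇒x∉q {x = zero}  {_ ∷ _} {inside  ∷ _} ()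
x∈p─q⇒x∉q {x = suc _} {_ ∷ _} {_       ∷ _} (there x∈) (there x∈q) = x∈p─q⇒x∉q x∈ x∈q

module _ {n : ℕ} where

  x∈p-y⇒x≢y : ∀ {x y : Fin n} {p} → x ∈ p - y → x ≢ y
  x∈p-y⇒x≢y = x∉⁅y⁆⇒x≢y ∘ x∈p─q⇒x∉q

  x∈p∪⁅y⁆⁻ : ∀ {x y : Fin n} {p} → x ∈ p ∪ ⁅ y ⁆ → x ∈ p ⊎ x ≡ y
  x∈p∪⁅y⁆⁻ {y = y} {p} = Sum.map₂ (x∈⁅y⁆⇒x≡y y) ∘ x∈p∪q⁻ p ⁅ y ⁆

  x∈p⇒⁅x⁆⊆p : ∀ {x : Fin n} {p} → x ∈ p → ⁅ x ⁆ ⊆ p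
  x∈p⇒⁅x⁆⊆p {x} x∈p y∈⁅x⁆ = subst (_∈ _) (sym (x∈⁅y⁆⇒x≡y x y∈⁅x⁆)) x∈p

  p-x⊆q⇒p⊆q : ∀ {x : Fin n} {p q} → x ∈ q → p - x ⊆ q → p ⊆ q
  p-x⊆q⇒p⊆q {x} x∈q p-x⊆q {y} y∈p with y ≟ x
  ... | yes refl = x∈q
  ... | no  y≢x  = p-x⊆q (x∈p∧x≢y⇒x∈p-y y∈p y≢x)

  select : {P : Fin n → Set} → (∀ x → Dec (P x)) → Subset n
  select P? = tabulate (does ∘ P?)

  ∈-select⁺ : ∀ {P : Fin n → Set} (P? : ∀ x → Dec (P x)) {x} → P x → x ∈ select P?
  ∈-select⁺ P? {x} Px = lookup⇒[]= x _ (trans (lookup∘tabulate _ x) (dec-true (P? x) Px))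

  ∈-select⁻ : ∀ {P : Fin n → Set} (P? : ∀ x → Dec (P x)) {x} → x ∈ select P? → P x
  ∈-select⁻ P? {x} x∈ with P? x | trans (sym (lookup∘tabulate (does ∘ P?) x)) ([]=⇒lookup x∈)
  ... | yes Px | _  = Px
  ... | no  _  | ()

  ⊈⇒∃ : ∀ {p q : Subset n} → ¬ p ⊆ q → ∃ λ x → x ∈ p × x ∉ q
  ⊈⇒∃ {p} {q} p⊈q with nonempty? (p ─ q)
  ... | yes (x , x∈p─q) = x , p─q⊆p p q x∈p─q , x∈p─q⇒x∉q x∈p─q
  ... | no  empty       = ⊥-elim (p⊈q λ {x} x∈p →
    decidable-stable (x ∈? q) λ x∉q → empty (x , x∈p∧x∉q⇒x∈p─q x∈p x∉q))

  ⊆∧⊈⇒⊂ : ∀ {p q : Subset n} → p ⊆ q → ¬ q ⊆ p → p ⊂ q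
  ⊆∧⊈⇒⊂ p⊆q q⊈p = p⊆q , ⊈⇒∃ q⊈p

  Disjoint : Subset n → Subset n → Set
  Disjoint A X = ∀ {z} → z ∈ A → z ∉ X

  p∪q─p∪r≡q─r : ∀ {A X Y : Subset n} → Disjoint A X → (A ∪ X) ─ (A ∪ Y) ≡ X ─ Y
  p∪q─p∪r≡q─r {A} {X} {Y} A∩X=∅ = ⊆-antisym to from
    where
      to : (A ∪ X) ─ (A ∪ Y) ⊆ X ─ Y
      to z∈ with x∈p∪q⁻ A X (p─q⊆p _ _ z∈)
      ... | inj₁ z∈A = ⊥-elim (x∈p─q⇒x∉q z∈ (p⊆p∪q Y z∈A))
      ... | inj₂ z∈X = x∈p∧x∉q⇒x∈p─q z∈X (x∈p─q⇒x∉q z∈ ∘ q⊆p∪q A Y)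
      from : X ─ Y ⊆ (A ∪ X) ─ (A ∪ Y)
      from z∈ = x∈p∧x∉q⇒x∈p─q (q⊆p∪q A X (p─q⊆p _ _ z∈)) λ z∈A∪Y → case x∈p∪q⁻ A Y z∈A∪Y of λ where
        (inj₁ z∈A) → A∩X=∅ z∈A (p─q⊆p _ _ z∈)
        (inj₂ z∈Y) → x∈p─q⇒x∉q z∈ z∈Y

  p∪q─p≡q : ∀ {A X : Subset n} → Disjoint A X → (A ∪ X) ─ A ≡ X
  p∪q─p≡q {A} {X} A∩X=∅ = begin
    (A ∪ X) ─ A        ≡⟨ cong ((A ∪ X) ─_) (sym (∪-identityʳ A)) ⟩
    (A ∪ X) ─ (A ∪ ∅)  ≡⟨ p∪q─p∪r≡q─r A∩X=∅ ⟩
    X ─ ∅              ≡⟨ p─⊥≡p X ⟩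
    X                  ∎
    where open ≡-Reasoning

  p⊆q⇒p∪[q─p]≡q : ∀ {A H : Subset n} → A ⊆ H → A ∪ (H ─ A) ≡ H
  p⊆q⇒p∪[q─p]≡q {A} {H} A⊆H = ⊆-antisym to from
    where
      to : A ∪ (H ─ A) ⊆ H
      to z∈ = case x∈p∪q⁻ A (H ─ A) z∈ of λ where
        (inj₁ z∈A)   → A⊆H z∈A
        (inj₂ z∈H─A) → p─q⊆p H A z∈H─A
      from : H ⊆ A ∪ (H ─ A)
      from {z} z∈H with z ∈? A
      ... | yes z∈A = p⊆p∪q (H ─ A) z∈A
      ... | no  z∉A = q⊆p∪q A (H ─ A) (x∈p∧x∉q⇒x∈p─q z∈H z∉A)

  pairs-or-escape : ∀ {X : Set} {Cov : Fin n → Fin n → Set} (A : Subset n) → (∀ a b → Dec (Cov a b)) →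
                    (∀ {a b} → a ∈ A → b ∈ A → X ⊎ Cov a b) → X ⊎ (∀ {a b} → a ∈ A → b ∈ A → Cov a b)
  pairs-or-escape A Cov? escape-or-cov with any? (λ a → any? (λ b → a ∈? A ×-dec b ∈? A ×-dec ¬? (Cov? a b)))
  ... | yes (a , b , a∈A , b∈A , ¬cov) = Sum.map id (⊥-elim ∘ ¬cov) (escape-or-cov a∈A b∈A)
  ... | no  none = inj₂ λ {a} {b} a∈A b∈A →
    decidable-stable (Cov? a b) λ ¬cov → none (a , b , a∈A , b∈A , ¬cov)

  ThreeDistinct : Subset n → Set
  ThreeDistinct A = ∃₂ λ a b → ∃ λ c → (a ∈ A × b ∈ A × c ∈ A) × (a ≢ b × a ≢ c × b ≢ c)

  AtMostTwo : Subset n → Set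
  AtMostTwo A = ∃₂ λ a b → a ∈ A × b ∈ A × (∀ {x} → x ∈ A → x ≡ a ⊎ x ≡ b)

  three-or-atMostTwo : ∀ A → ThreeDistinct A ⊎ AtMostTwo A ⊎ Empty A
  three-or-atMostTwo A with nonempty? A
  ... | no  empty = inj₂ (inj₂ empty)
  ... | yes (a , a∈A) with nonempty? (A - a)
  ...   | no  empty = inj₂ (inj₁ (a , a , a∈A , a∈A , λ {x} x∈A → inj₁ (only-a x∈A)))
    where
      only-a : ∀ {x} → x ∈ A → x ≡ a
      only-a {x} x∈A with x ≟ a
      ... | yes x≡a = x≡a
      ... | no  x≢a = ⊥-elim (empty (x , x∈p∧x≢y⇒x∈p-y x∈A x≢a))
  ...   | yes (b , b∈A-a) with nonempty? (A - a - b)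
  ...     | yes (c , c∈A-a-b) =
    inj₁ (a , b , c , (a∈A , b∈A , c∈A) , (b≢a ∘ sym , c≢a ∘ sym , c≢b ∘ sym))
    where
      b∈A = p─q⊆p A _ b∈A-a
      b≢a = x∈p-y⇒x≢y b∈A-a
      c∈A = p─q⊆p A _ (p─q⊆p (A - a) _ c∈A-a-b)
      c≢a = x∈p-y⇒x≢y (p─q⊆p (A - a) _ c∈A-a-b)
      c≢b = x∈p-y⇒x≢y c∈A-a-b
  ...     | no  empty = inj₂ (inj₁ (a , b , a∈A , p─q⊆p A _ b∈A-a , a-or-b))
    where
      a-or-b : ∀ {x} → x ∈ A → x ≡ a ⊎ x ≡ b
      a-or-b {x} x∈A with x ≟ a | x ≟ b
      ... | yes x≡a | _       = inj₁ x≡a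
      ... | no  _   | yes x≡b = inj₂ x≡b
      ... | no  x≢a | no  x≢b = ⊥-elim (empty (x , x∈p∧x≢y⇒x∈p-y (x∈p∧x≢y⇒x∈p-y x∈A x≢a) x≢b))

∣∣+∣∣-mono-< : ∀ {m k} {p p′ : Subset m} {r r′ : Subset k} → p ⊆ p′ → r ⊆ r′ → ¬ (p′ ⊆ p × r′ ⊆ r) →
               ∣ p ∣ + ∣ r ∣ < ∣ p′ ∣ + ∣ r′ ∣
∣∣+∣∣-mono-< {p = p} {p′} {r} {r′} p⊆p′ r⊆r′ ¬both with p′ ⊆? p | r′ ⊆? r
... | no  p′⊈p | _         = +-mono-<-≤ (p⊂q⇒∣p∣<∣q∣ (⊆∧⊈⇒⊂ p⊆p′ p′⊈p)) (p⊆q⇒∣p∣≤∣q∣ r⊆r′)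
... | yes _    | no  r′⊈r = +-mono-≤-< (p⊆q⇒∣p∣≤∣q∣ p⊆p′) (p⊂q⇒∣p∣<∣q∣ (⊆∧⊈⇒⊂ r⊆r′ r′⊈r))
... | yes p′⊆p | yes r′⊆r = ⊥-elim (¬both (p′⊆p , r′⊆r))

infix 4 _⊆[_]_
_⊆[_]_ : ∀ {n} → Subset n → Subset n → Subset n → Set
A ⊆[ R ] B = ∀ {y} → y ∈ R → y ∈ A → y ∈ B

⊆[]-─ : ∀ {n} {X Y R C : Subset n} → X ⊆[ R ] Y → X ─ C ⊆[ R ] Y ─ C
⊆[]-─ X⊆Y y∈R y∈X─C = x∈p∧x∉q⇒x∈p─q (X⊆Y y∈R (p─q⊆p _ _ y∈X─C)) (x∈p─q⇒x∉q y∈X─C)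

Nest : ∀ {n q} → Family n q → Subset n → Subset q → Fin n → Set
Nest E R K x = ∀ {i j} → i ∈ K → j ∈ K → x ∈ E i → x ∈ E j → E i ⊆[ R ] E j ⊎ E j ⊆[ R ] E i

-- Special cycles

∣∷∣ : ∀ {m} (b : Bool) (v : Vec Bool m) → ∣ b ∷ v ∣ ≡ (if b then suc ∣ v ∣ else ∣ v ∣)
∣∷∣ true  v = refl
∣∷∣ false v = refl

count1-suc : ∀ {k} (f : Fin (suc k) → Bool) →
             count1 f ≡ (if f zero then suc (count1 (f ∘ suc)) else count1 (f ∘ suc))
count1-suc f = ∣∷∣ (f zero) (tabulate (f ∘ suc))

count1≡0 : ∀ {k} (f : Fin k → Bool) → (∀ b → f b ≢ true) → count1 f ≡ 0
count1≡0 {zero}  f none = refl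
count1≡0 {suc k} f none rewrite count1-suc f | ¬-not (none zero) =
  count1≡0 (f ∘ suc) (none ∘ suc)

count1≡1 : ∀ {k} (f : Fin k → Bool) {b₁} → f b₁ ≡ true →
           (∀ b → f b ≡ true → b ≡ b₁) → count1 f ≡ 1
count1≡1 {suc k} f {zero} fb₁ only rewrite count1-suc f | fb₁ =
  cong suc (count1≡0 (f ∘ suc) λ b fb → case (only (suc b) fb) of λ ())
count1≡1 {suc k} f {suc b₁} fb₁ only rewrite count1-suc f | ¬-not (λ f0 → case only zero f0 of λ ()) =
  count1≡1 (f ∘ suc) fb₁ (λ b fb → suc-injective (only (suc b) fb))

count1≡2 : ∀ {k} (f : Fin k → Bool) {b₁ b₂} → b₁ ≢ b₂ → f b₁ ≡ true → f b₂ ≡ true →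
           (∀ b → f b ≡ true → b ≡ b₁ ⊎ b ≡ b₂) → count1 f ≡ 2
count1≡2 f {zero} {zero} b₁≢b₂ _ _ _ = ⊥-elim (b₁≢b₂ refl)
count1≡2 {suc k} f {zero} {suc b₂} _ fb₁ fb₂ only rewrite count1-suc f | fb₁ =
  cong suc (count1≡1 (f ∘ suc) fb₂ λ b fb → case only (suc b) fb of λ where
    (inj₂ eq) → suc-injective eq)
count1≡2 {suc k} f {suc b₁} {zero} _ fb₁ fb₂ only rewrite count1-suc f | fb₂ =
  cong suc (count1≡1 (f ∘ suc) fb₁ λ b fb → case only (suc b) fb of λ where
    (inj₁ eq) → suc-injective eq)
count1≡2 {suc k} f {suc b₁} {suc b₂} b₁≢b₂ fb₁ fb₂ only
  rewrite count1-suc f | ¬-not (λ f0 → case only zero f0 of λ { (inj₁ ()) ; (inj₂ ()) }) =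
  count1≡2 (f ∘ suc) (b₁≢b₂ ∘ cong suc) fb₁ fb₂ λ b fb → case only (suc b) fb of λ where
    (inj₁ eq) → inj₁ (suc-injective eq)
    (inj₂ eq) → inj₂ (suc-injective eq)

-- Vertex a lies on edge b of the special cycle x₀ E₀ x₁ E₁ ⋯ x_L E_L x₀.
data CycleIncidence (L : ℕ) : ℕ → ℕ → Set where
  here : ∀ {b} → CycleIncidence L b b
  next : ∀ {b} → CycleIncidence L (suc b) b
  wrap : CycleIncidence L 0 L

cycleIncidence-antisym : ∀ {L a b} → 2 ≤ L → CycleIncidence L a b → CycleIncidence L b a → a ≡ b
cycleIncidence-antisym _         here _    = refl
cycleIncidence-antisym _         _    here = refl
cycleIncidence-antisym (s≤s ()) next wrap
cycleIncidence-antisym (s≤s ()) wrap next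
cycleIncidence-antisym ()        wrap wrap

record ExactlyTwo (L : ℕ) (P : ℕ → Set) : Set where
  constructor exactlyTwo
  field
    {m₁ m₂} : ℕ
    m₁≤L    : m₁ ≤ L
    m₂≤L    : m₂ ≤ L
    m₁≢m₂   : m₁ ≢ m₂
    P-m₁    : P m₁
    P-m₂    : P m₂
    only    : ∀ {m} → m ≤ L → P m → m ≡ m₁ ⊎ m ≡ m₂

count1∘toℕ≡2 : ∀ {L} {P : ℕ → Set} (g : ℕ → Bool) →
                (∀ {m} → m ≤ L → g m ≡ true → P m) → (∀ {m} → m ≤ L → P m → g m ≡ true) →
                ExactlyTwo L P → count1 {suc L} (g ∘ toℕ) ≡ 2
count1∘toℕ≡2 {L} {P} g sound complete (exactlyTwo m₁≤L m₂≤L m₁≢m₂ P-m₁ P-m₂ only) =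
  count1≡2 (g ∘ toℕ) (m₁≢m₂ ∘ fromℕ<-injective _ _ (s≤s m₁≤L) (s≤s m₂≤L)) (at m₁≤L P-m₁) (at m₂≤L P-m₂) λ b gb →
    case only (≤L b) (sound (≤L b) gb) of λ where
      (inj₁ eq) → inj₁ (toℕ-injective (trans eq (sym (toℕ-fromℕ< (s≤s m₁≤L)))))
      (inj₂ eq) → inj₂ (toℕ-injective (trans eq (sym (toℕ-fromℕ< (s≤s m₂≤L)))))
  where
    ≤L : (b : Fin (suc L)) → toℕ b ≤ L
    ≤L b = s≤s⁻¹ (toℕ<n b)
    at : ∀ {m} (m≤L : m ≤ L) → P m → g (toℕ (fromℕ< (s≤s m≤L))) ≡ true
    at m≤L Pm rewrite toℕ-fromℕ< (s≤s m≤L) = complete m≤L Pm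

cycle-row : ∀ {L a} → 2 ≤ L → a ≤ L → ExactlyTwo L (CycleIncidence L a)
cycle-row {L} {zero}  2≤L _   = exactlyTwo z≤n ≤-refl 0≢L here wrap only
  where
    0≢L : 0 ≢ L
    0≢L refl = case 2≤L of λ ()
    only : ∀ {m} → m ≤ L → CycleIncidence L 0 m → m ≡ 0 ⊎ m ≡ L
    only _ here = inj₁ refl
    only _ wrap = inj₂ refl
cycle-row {L} {suc a} _ a<L = exactlyTwo (<⇒≤ a<L) a<L (1+n≢n ∘ sym) next here only
  where
    only : ∀ {m} → m ≤ L → CycleIncidence L (suc a) m → m ≡ a ⊎ m ≡ suc a
    only _ here = inj₂ refl
    only _ next = inj₁ refl

cycle-column : ∀ {L b} → 2 ≤ L → b ≤ L → ExactlyTwo L (λ a → CycleIncidence L a b)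
cycle-column {L} {b} 2≤L b≤L with m≤n⇒m<n∨m≡n b≤L
... | inj₁ b<L  = exactlyTwo b≤L b<L (1+n≢n ∘ sym) here next only
  where
    only : ∀ {m} → m ≤ L → CycleIncidence L m b → m ≡ b ⊎ m ≡ suc b
    only _ here = inj₁ refl
    only _ next = inj₂ refl
    only _ wrap = ⊥-elim (<-irrefl refl b<L)
... | inj₂ refl = exactlyTwo ≤-refl z≤n L≢0 here wrap only
  where
    L≢0 : L ≢ 0
    L≢0 refl = case 2≤L of λ ()
    only : ∀ {m} → m ≤ L → CycleIncidence L m L → m ≡ L ⊎ m ≡ 0
    only _   here = inj₁ refl
    only 1+L≤L next = ⊥-elim (<-irrefl refl 1+L≤L)
    only _   wrap = inj₂ refl

module _ {n q} {S : Family n q} (tb : TotallyBalanced S) where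

  no-special-cycle : ∀ {L} → 2 ≤ L → (v : ℕ → Fin n) (e : ℕ → Fin q) →
                     (∀ {a b} → a ≤ L → b ≤ L → v a ∈ S (e b) → CycleIncidence L a b) →
                     (∀ {a b} → a ≤ L → b ≤ L → CycleIncidence L a b → v a ∈ S (e b)) → ⊥
  no-special-cycle {L} 2≤L v e sound complete =
    tb (suc L) (s≤s 2≤L) r c (r-injective , c-injective , rows , columns)
    where
      r : Fin (suc L) → Fin n
      r a = v (toℕ a)
      c : Fin (suc L) → Fin q
      c b = e (toℕ b)
      ≤L : (a : Fin (suc L)) → toℕ a ≤ L
      ≤L a = s≤s⁻¹ (toℕ<n a)
      r-injective : ∀ {a a'} → r a ≡ r a' → a ≡ a'
      r-injective {a} {a'} eq = toℕ-injective (cycleIncidence-antisym 2≤L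
        (sound (≤L a) (≤L a') (subst (_∈ S (c a')) (sym eq) (complete (≤L a') (≤L a') here)))
        (sound (≤L a') (≤L a) (subst (_∈ S (c a)) eq (complete (≤L a) (≤L a) here))))
      c-injective : ∀ {b b'} → c b ≡ c b' → b ≡ b'
      c-injective {b} {b'} eq = toℕ-injective (cycleIncidence-antisym 2≤L
        (sound (≤L b) (≤L b') (subst (λ j → r b ∈ S j) eq (complete (≤L b) (≤L b) here)))
        (sound (≤L b') (≤L b) (subst (λ j → r b' ∈ S j) (sym eq) (complete (≤L b') (≤L b') here))))
      rows : ∀ a → count1 (λ b → incidence S (r a) (c b)) ≡ 2
      rows a = count1∘toℕ≡2 _ (λ b≤L → sound (≤L a) b≤L ∘ lookup⇒[]= _ _)
                               (λ b≤L → []=⇒lookup ∘ complete (≤L a) b≤L) (cycle-row 2≤L (≤L a))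
      columns : ∀ b → count1 (λ a → incidence S (r a) (c b)) ≡ 2
      columns b = count1∘toℕ≡2 _ (λ a≤L → sound a≤L (≤L b) ∘ lookup⇒[]= _ _)
                                  (λ a≤L → []=⇒lookup ∘ complete a≤L (≤L b)) (cycle-column 2≤L (≤L b))

  no-triangle : ∀ {a₀ a₁ a₂ f₀ f₁ f₂} → a₀ ∉ S f₀ → a₁ ∉ S f₁ → a₂ ∉ S f₂ →
                a₁ ∈ S f₀ → a₂ ∈ S f₀ → a₀ ∈ S f₁ → a₂ ∈ S f₁ → a₀ ∈ S f₂ → a₁ ∈ S f₂ → ⊥
  no-triangle {a₀} {a₁} {a₂} {f₀} {f₁} {f₂} a₀∉f₀ a₁∉f₁ a₂∉f₂ a₁∈f₀ a₂∈f₀ a₀∈f₁ a₂∈f₁ a₀∈f₂ a₁∈f₂ =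
    no-special-cycle ≤-refl v e sound complete
    where
      v : ℕ → Fin n
      v 0 = a₀
      v 1 = a₁
      v _ = a₂
      e : ℕ → Fin q
      e 0 = f₂
      e 1 = f₀
      e _ = f₁
      sound : ∀ {a b} → a ≤ 2 → b ≤ 2 → v a ∈ S (e b) → CycleIncidence 2 a b
      sound {0} {0} _ _ _ = here
      sound {0} {1} _ _ m = ⊥-elim (a₀∉f₀ m)
      sound {0} {2} _ _ _ = wrap
      sound {1} {0} _ _ _ = next
      sound {1} {1} _ _ _ = here
      sound {1} {2} _ _ m = ⊥-elim (a₁∉f₁ m)
      sound {2} {0} _ _ m = ⊥-elim (a₂∉f₂ m)
      sound {2} {1} _ _ _ = next
      sound {2} {2} _ _ _ = here
      sound {suc (suc (suc _))} (s≤s (s≤s ())) _ _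
      sound {_} {suc (suc (suc _))} _ (s≤s (s≤s ())) _
      complete : ∀ {a b} → a ≤ 2 → b ≤ 2 → CycleIncidence 2 a b → v a ∈ S (e b)
      complete {0} _ _ here = a₀∈f₂
      complete {1} _ _ here = a₁∈f₀
      complete {2} _ _ here = a₂∈f₁
      complete {1} _ _ next = a₁∈f₂
      complete {2} _ _ next = a₂∈f₀
      complete _ _ wrap = a₀∈f₁
      complete {suc (suc (suc _))} (s≤s (s≤s ())) _ _

  cover-from-deletions : ∀ {K : Subset q} {A} → ThreeDistinct A →
                         (∀ {a} → a ∈ A → ∃ λ j → j ∈ K × A - a ⊆ S j) → ∃ λ j → j ∈ K × A ⊆ S j
  cover-from-deletions {K} {A} (a₀ , a₁ , a₂ , (a₀∈A , a₁∈A , a₂∈A) , (a₀≢a₁ , a₀≢a₂ , a₁≢a₂)) cover-without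
    with cover-without a₀∈A | cover-without a₁∈A | cover-without a₂∈A
  ... | f₀ , f₀∈K , A-a₀⊆f₀ | f₁ , f₁∈K , A-a₁⊆f₁ | f₂ , f₂∈K , A-a₂⊆f₂
    with a₀ ∈? S f₀ | a₁ ∈? S f₁ | a₂ ∈? S f₂
  ... | yes a₀∈f₀ | _          | _          = f₀ , f₀∈K , p-x⊆q⇒p⊆q a₀∈f₀ A-a₀⊆f₀
  ... | no _      | yes a₁∈f₁ | _          = f₁ , f₁∈K , p-x⊆q⇒p⊆q a₁∈f₁ A-a₁⊆f₁
  ... | no _      | no _       | yes a₂∈f₂ = f₂ , f₂∈K , p-x⊆q⇒p⊆q a₂∈f₂ A-a₂⊆f₂
  ... | no a₀∉f₀  | no a₁∉f₁   | no a₂∉f₂  = ⊥-elim (no-triangle a₀∉f₀ a₁∉f₁ a₂∉f₂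
    (A-a₀⊆f₀ (x∈p∧x≢y⇒x∈p-y a₁∈A (a₀≢a₁ ∘ sym))) (A-a₀⊆f₀ (x∈p∧x≢y⇒x∈p-y a₂∈A (a₀≢a₂ ∘ sym)))
    (A-a₁⊆f₁ (x∈p∧x≢y⇒x∈p-y a₀∈A a₀≢a₁)) (A-a₁⊆f₁ (x∈p∧x≢y⇒x∈p-y a₂∈A (a₁≢a₂ ∘ sym)))
    (A-a₂⊆f₂ (x∈p∧x≢y⇒x∈p-y a₀∈A a₀≢a₂)) (A-a₂⊆f₂ (x∈p∧x≢y⇒x∈p-y a₁∈A a₁≢a₂)))

  conformal : ∀ {K : Subset q} → Nonempty K → ∀ A →
              (∀ {a b} → a ∈ A → b ∈ A → ∃ λ j → j ∈ K × a ∈ S j × b ∈ S j) →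
              ∃ λ j → j ∈ K × A ⊆ S j
  conformal {K} (j₀ , j₀∈K) A = cover A (<-wellFounded ∣ A ∣)
    where
      cover : ∀ A → Acc _<_ ∣ A ∣ → (∀ {a b} → a ∈ A → b ∈ A → ∃ λ j → j ∈ K × a ∈ S j × b ∈ S j) →
              ∃ λ j → j ∈ K × A ⊆ S j
      cover A (acc rec) pairs with three-or-atMostTwo A
      ... | inj₁ three = cover-from-deletions three λ a∈A →
        cover (A - _) (rec (x∈p⇒∣p-x∣<∣p∣ a∈A)) λ a∈ b∈ → pairs (p─q⊆p A _ a∈) (p─q⊆p A _ b∈)
      ... | inj₂ (inj₂ empty) = j₀ , j₀∈K , λ x∈A → ⊥-elim (empty (_ , x∈A))
      ... | inj₂ (inj₁ (a , b , a∈A , b∈A , a-or-b)) with pairs a∈A b∈A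
      ...   | j , j∈K , a∈j , b∈j = j , j∈K , λ x∈A → case a-or-b x∈A of λ where
        (inj₁ refl) → a∈j
        (inj₂ refl) → b∈j

-- Walks

any<? : ∀ N {P : ℕ → Set} → (∀ i → Dec (P i)) → Dec (∃ λ i → i < N × P i)
any<? N {P} P? = map′ (λ (i , Pi) → toℕ i , toℕ<n i , Pi)
                      (λ (i , i<N , Pi) → fromℕ< i<N , subst P (sym (toℕ-fromℕ< i<N)) Pi)
                      (any? (P? ∘ toℕ))

ifLE : ∀ {A : Set} → ℕ → ℕ → A → A → A
ifLE zero    _       x _ = x
ifLE (suc _) zero    _ y = y
ifLE (suc m) (suc a) x y = ifLE m a x y

ifLE-≤ : ∀ {A : Set} {m a} {x y : A} → m ≤ a → ifLE m a x y ≡ x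
ifLE-≤ {m = zero}  _         = refl
ifLE-≤ {m = suc m} (s≤s m≤a) = ifLE-≤ {m = m} m≤a

ifLE-> : ∀ {A : Set} {m a} {x y : A} → a < m → ifLE m a x y ≡ y
ifLE-> {m = suc m} {zero}  _         = refl
ifLE-> {m = suc m} {suc a} (s≤s a<m) = ifLE-> {m = m} a<m

module Walks {n q} (S : Family n q) where

  -- Only vertex 0 … vertex len and edge 0 … edge (len ∸ 1) carry information.
  record Walk : Set where
    field
      len    : ℕ
      vertex : ℕ → Fin n
      edge   : ℕ → Fin q
      step   : ∀ {i} → i < len → vertex i ∈ S (edge i) × vertex (suc i) ∈ S (edge i)

    start end : Fin n
    start = vertex 0
    end   = vertex len

  open Walk public

  single : ∀ {x y} (j : Fin q) → x ∈ S j → y ∈ S j → Walk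
  single {x} {y} j x∈j y∈j = record
    { len = 1 ; vertex = λ m → ifLE m 0 x y ; edge = λ _ → j ; step = λ { (s≤s z≤n) → x∈j , y∈j } }

  module Extend (w : Walk) {j : Fin q} {y : Fin n} (end∈j : end w ∈ S j) (y∈j : y ∈ S j) where

    vertex′ : ℕ → Fin n
    vertex′ m = ifLE m (len w) (vertex w m) y

    edge′ : ℕ → Fin q
    edge′ m = ifLE (suc m) (len w) (edge w m) j

    step′ : ∀ {i} → i < suc (len w) → vertex′ i ∈ S (edge′ i) × vertex′ (suc i) ∈ S (edge′ i)
    step′ {i} (s≤s i≤len) with m≤n⇒m<n∨m≡n i≤len
    ... | inj₁ i<len rewrite ifLE-≤ {x = vertex w i} {y} (<⇒≤ i<len) | ifLE-≤ {x = edge w i} {j} i<len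
                           | ifLE-≤ {x = vertex w (suc i)} {y} i<len = step w i<len
    ... | inj₂ refl  rewrite ifLE-≤ {x = vertex w i} {y} (≤-refl {i}) | ifLE-> {x = edge w i} {j} (≤-refl {suc i})
                           | ifLE-> {x = vertex w (suc i)} {y} (≤-refl {suc i}) = end∈j , y∈j

    walk′ : Walk
    walk′ = record { len = suc (len w) ; vertex = vertex′ ; edge = edge′ ; step = step′ }

    end′ : end walk′ ≡ y
    end′ = ifLE-> {m = suc (len w)} ≤-refl

    old-vertex : ∀ {m} → m ≤ len w → vertex′ m ≡ vertex w m
    old-vertex = ifLE-≤

    new-or-old-edge : ∀ {m} → m < suc (len w) → edge′ m ≡ j ⊎ (m < len w × edge′ m ≡ edge w m)
    new-or-old-edge {m} (s≤s m≤len) with m≤n⇒m<n∨m≡n m≤len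
    ... | inj₁ m<len = inj₂ (m<len , ifLE-≤ m<len)
    ... | inj₂ refl  = inj₁ (ifLE-> {m = suc m} ≤-refl)

  -- Replaces the steps of w from vertex a to vertex a + 1 + δ by the single edge j.
  module Shortcut (w : Walk) {a δ r : ℕ} (len≡ : len w ≡ suc (a + δ) + r) {j : Fin q}
                  (a∈j : vertex w a ∈ S j) (a+1+δ∈j : vertex w (suc a + δ) ∈ S j) where

    1+a+r+δ≡len : suc (a + r) + δ ≡ len w
    1+a+r+δ≡len = trans (cong suc (trans (+-assoc a r δ) (trans (cong (a +_) (+-comm r δ)) (sym (+-assoc a δ r)))))
                        (sym len≡)

    shift : ∀ {i} → i < suc (a + r) → i + δ < len w
    shift {i} i<1+a+r = subst (i + δ <_) 1+a+r+δ≡len (+-monoˡ-< δ i<1+a+r)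

    a<len : a < len w
    a<len = subst (a <_) (sym len≡) (s≤s (≤-trans (m≤m+n a δ) (m≤m+n (a + δ) r)))

    vertex′ : ℕ → Fin n
    vertex′ m = ifLE m a (vertex w m) (vertex w (m + δ))

    edge′ : ℕ → Fin q
    edge′ m = ifLE (suc m) a (edge w m) (ifLE m a j (edge w (m + δ)))

    step′ : ∀ {i} → i < suc (a + r) → vertex′ i ∈ S (edge′ i) × vertex′ (suc i) ∈ S (edge′ i)
    step′ {i} i<len′ with <-cmp i a
    ... | tri< i<a _ _ rewrite ifLE-≤ {x = vertex w i} {vertex w (i + δ)} (<⇒≤ i<a)
                             | ifLE-≤ {x = vertex w (suc i)} {vertex w (suc i + δ)} i<a
                             | ifLE-≤ {x = edge w i} {ifLE i a j (edge w (i + δ))} i<a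
      = step w (<-trans i<a a<len)
    ... | tri≈ _ refl _ rewrite ifLE-≤ {x = vertex w i} {vertex w (i + δ)} (≤-refl {i})
                              | ifLE-> {x = vertex w (suc i)} {vertex w (suc i + δ)} (≤-refl {suc i})
                              | ifLE-> {x = edge w i} {ifLE i i j (edge w (i + δ))} (≤-refl {suc i})
                              | ifLE-≤ {x = j} {edge w (i + δ)} (≤-refl {i})
      = a∈j , a+1+δ∈j
    ... | tri> _ _ a<i rewrite ifLE-> {x = vertex w i} {vertex w (i + δ)} a<i
                             | ifLE-> {x = vertex w (suc i)} {vertex w (suc i + δ)} (m<n⇒m<1+n a<i)
                             | ifLE-> {x = edge w i} {ifLE i a j (edge w (i + δ))} (m<n⇒m<1+n a<i)
                             | ifLE-> {x = j} {edge w (i + δ)} a<i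
      = step w (shift i<len′)

    walk′ : Walk
    walk′ = record { len = suc (a + r) ; vertex = vertex′ ; edge = edge′ ; step = step′ }

    end′ : end walk′ ≡ end w
    end′ = trans (ifLE-> {m = suc (a + r)} (s≤s (m≤m+n a r))) (cong (vertex w) 1+a+r+δ≡len)

    old-inner-vertex : ∀ {m} → 0 < m → m < suc (a + r) → ∃ λ m₀ → 0 < m₀ × m₀ < len w × vertex′ m ≡ vertex w m₀
    old-inner-vertex {m} 0<m m<len′ with ≤-<-connex m a
    ... | inj₁ m≤a = m , 0<m , ≤-<-trans m≤a a<len , ifLE-≤ m≤a
    ... | inj₂ a<m = m + δ , ≤-trans 0<m (m≤m+n m δ) , shift m<len′ , ifLE-> a<m

    new-or-old-edge : ∀ {m} → m < suc (a + r) → edge′ m ≡ j ⊎ ∃ λ m₀ → m₀ < len w × edge′ m ≡ edge w m₀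
    new-or-old-edge {m} m<len′ with <-cmp m a
    ... | tri< m<a _ _ = inj₂ (m , <-trans m<a a<len , ifLE-≤ m<a)
    ... | tri≈ _ refl _ = inj₁ (trans (ifLE-> {m = suc m} ≤-refl) (ifLE-≤ {m = m} ≤-refl))
    ... | tri> _ _ a<m = inj₂ (m + δ , shift m<len′ , trans (ifLE-> {m = suc m} (m<n⇒m<1+n a<m)) (ifLE-> a<m))

    shorter : 0 < δ → suc (a + r) < len w
    shorter 0<δ = subst (suc (a + r) <_) (sym len≡) (s≤s (+-monoˡ-< r (m<m+n a 0<δ)))

  Chord : Walk → Set
  Chord w = ∃ λ i → i < suc (len w) × ∃ λ j → j < len w × vertex w i ∈ S (edge w j) × i ≢ j × i ≢ suc j

  chord? : ∀ w → Dec (Chord w)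
  chord? w = any<? (suc (len w)) λ i → any<? (len w) λ j →
               vertex w i ∈? S (edge w j) ×-dec ¬? (i ℕ.≟ j) ×-dec ¬? (i ℕ.≟ suc j)

  Chordless : Walk → Set
  Chordless w = ∀ {i j} → i ≤ len w → j < len w → vertex w i ∈ S (edge w j) → i ≡ j ⊎ i ≡ suc j

  ¬chord⇒chordless : ∀ w → ¬ Chord w → Chordless w
  ¬chord⇒chordless w ¬chord {i} {j} i≤len j<len i∈j with i ℕ.≟ j | i ℕ.≟ suc j
  ... | yes i≡j | _         = inj₁ i≡j
  ... | no _    | yes i≡1+j = inj₂ i≡1+j
  ... | no i≢j  | no i≢1+j  = ⊥-elim (¬chord (i , s≤s i≤len , j , j<len , i∈j , i≢j , i≢1+j))

  module _ (d : Fin q) (P : Fin q → Set) where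

    record Excursion (w : Walk) : Set where
      field
        start∈d   : start w ∈ S d
        end∈d     : end w ∈ S d
        start≢end : start w ≢ end w
        inner∉d   : ∀ {m} → 0 < m → m < len w → vertex w m ∉ S d
        edge-P    : ∀ {m} → m < len w → P (edge w m)

    open Excursion

    ShorterExcursion : Walk → Set
    ShorterExcursion w = ∃ λ w′ → len w′ < len w × start w′ ≡ start w × end w′ ≡ end w × Excursion w′

    shortcut-excursion : ∀ w {a δ r} (len≡ : len w ≡ suc (a + δ) + r) {j}
                         (a∈j : vertex w a ∈ S (edge w j)) (b∈j : vertex w (suc a + δ) ∈ S (edge w j)) →
                         j < len w → 0 < δ → Excursion w → ShorterExcursion w
    shortcut-excursion w len≡ {j} a∈j b∈j j<len 0<δ ex =
      walk′ , shorter 0<δ , refl , end′ , record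
        { start∈d   = start∈d ex
        ; end∈d     = subst (_∈ S d) (sym end′) (end∈d ex)
        ; start≢end = λ eq → start≢end ex (trans eq end′)
        ; inner∉d   = λ 0<m m<len → let (m₀ , 0<m₀ , m₀<len , eq) = old-inner-vertex 0<m m<len
                                     in subst (_∉ S d) (sym eq) (inner∉d ex 0<m₀ m₀<len)
        ; edge-P    = λ m<len → case new-or-old-edge m<len of λ where
                        (inj₁ eq) → subst P (sym eq) (edge-P ex j<len)
                        (inj₂ (m₀ , m₀<len , eq)) → subst P (sym eq) (edge-P ex m₀<len)
        }
      where open Shortcut w len≡ a∈j b∈j

    chord⇒shorter : ∀ w → Excursion w → Chord w → ShorterExcursion w
    chord⇒shorter w ex (i , s≤s i≤len , j , j<len , i∈j , i≢j , i≢1+j) with <-cmp i j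
    ... | tri≈ _ i≡j _ = ⊥-elim (i≢j i≡j)
    ... | tri< i<j _ _ = shortcut-excursion w len≡ i∈j b∈j j<len (m<n⇒0<n∸m i<j) ex
      where
        i+δ≡j : i + (j ∸ i) ≡ j
        i+δ≡j = m+[n∸m]≡n (<⇒≤ i<j)
        len≡ : len w ≡ suc (i + (j ∸ i)) + (len w ∸ suc j)
        len≡ = trans (sym (m+[n∸m]≡n j<len)) (cong (λ k → suc k + (len w ∸ suc j)) (sym i+δ≡j))
        b∈j : vertex w (suc i + (j ∸ i)) ∈ S (edge w j)
        b∈j = subst (λ k → vertex w (suc k) ∈ S (edge w j)) (sym i+δ≡j) (proj₂ (step w j<len))
    ... | tri> _ _ j<i = shortcut-excursion w len≡ (proj₁ (step w j<len)) b∈j j<len (m<n⇒0<n∸m 1+j<i) ex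
      where
        1+j<i : suc j < i
        1+j<i = ≤∧≢⇒< j<i (i≢1+j ∘ sym)
        1+j+δ≡i : suc j + (i ∸ suc j) ≡ i
        1+j+δ≡i = m+[n∸m]≡n (<⇒≤ 1+j<i)
        len≡ : len w ≡ suc (j + (i ∸ suc j)) + (len w ∸ i)
        len≡ = trans (sym (m+[n∸m]≡n i≤len)) (cong (_+ (len w ∸ i)) (sym 1+j+δ≡i))
        b∈j : vertex w (suc j + (i ∸ suc j)) ∈ S (edge w j)
        b∈j = subst (λ k → vertex w k ∈ S (edge w j)) (sym 1+j+δ≡i) i∈j

    chordless-excursion : TotallyBalanced S → ∀ w → Excursion w → Chordless w →
                          ∃ λ g → P g × start w ∈ S g × end w ∈ S g
    chordless-excursion tb w ex chordless = by-length (len w) refl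
      where
        by-length : ∀ L → len w ≡ L → ∃ λ g → P g × start w ∈ S g × end w ∈ S g
        by-length 0 len≡0 = ⊥-elim (start≢end ex (cong (vertex w) (sym len≡0)))
        by-length 1 len≡1 = edge w 0 , edge-P ex 0<len , proj₁ (step w 0<len) ,
                            subst (λ k → vertex w k ∈ S (edge w 0)) (sym len≡1) (proj₂ (step w 0<len))
          where
            0<len : 0 < len w
            0<len = subst (0 <_) (sym len≡1) (s≤s z≤n)
        -- Closed up by d, a chordless excursion of length at least 2 is a special cycle.
        by-length (suc (suc _)) len≡ =
          ⊥-elim (no-special-cycle {S = S} tb 2≤len (vertex w) e sound complete)
          where
            2≤len : 2 ≤ len w
            2≤len = subst (2 ≤_) (sym len≡) (s≤s (s≤s z≤n))
            e : ℕ → Fin q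
            e b = ifLE (suc b) (len w) (edge w b) d
            sound : ∀ {a b} → a ≤ len w → b ≤ len w → vertex w a ∈ S (e b) → CycleIncidence (len w) a b
            sound {a} {b} a≤len b≤len a∈b with m≤n⇒m<n∨m≡n b≤len
            ... | inj₁ b<len with chordless a≤len b<len (subst (λ j → vertex w a ∈ S j) (ifLE-≤ b<len) a∈b)
            ...   | inj₁ refl = here
            ...   | inj₂ refl = next
            sound {a} {b} a≤len b≤len a∈b | inj₂ refl with a | m≤n⇒m<n∨m≡n a≤len
            ... | zero   | _          = wrap
            ... | suc _  | inj₂ refl  = here
            ... | suc a′ | inj₁ a<len = ⊥-elim (inner∉d ex (s≤s z≤n) a<len
                                          (subst (λ j → vertex w (suc a′) ∈ S j) (ifLE-> {m = suc b} ≤-refl) a∈b))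
            complete : ∀ {a b} → a ≤ len w → b ≤ len w → CycleIncidence (len w) a b → vertex w a ∈ S (e b)
            complete {b = b} _ b≤len here with m≤n⇒m<n∨m≡n b≤len
            ... | inj₁ b<len = subst (λ j → vertex w b ∈ S j) (sym (ifLE-≤ b<len)) (proj₁ (step w b<len))
            ... | inj₂ refl  = subst (λ j → end w ∈ S j) (sym (ifLE-> {m = suc b} ≤-refl)) (end∈d ex)
            complete {b = b} b<len _ next =
              subst (λ j → vertex w (suc b) ∈ S j) (sym (ifLE-≤ b<len)) (proj₂ (step w b<len))
            complete _ _ wrap = subst (λ j → start w ∈ S j) (sym (ifLE-> {m = suc (len w)} ≤-refl)) (start∈d ex)

    excursion-edge : TotallyBalanced S → ∀ w → Excursion w → ∃ λ g → P g × start w ∈ S g × end w ∈ S g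
    excursion-edge tb w = shorten w (<-wellFounded (len w))
      where
        shorten : ∀ w → Acc _<_ (len w) → Excursion w → ∃ λ g → P g × start w ∈ S g × end w ∈ S g
        shorten w (acc rec) ex with chord? w
        ... | no ¬chord = chordless-excursion tb w ex (¬chord⇒chordless w ¬chord)
        ... | yes chord with chord⇒shorter w ex chord
        ...   | w′ , shorter , start≡ , end≡ , ex′ with shorten w′ (rec shorter) ex′
        ...     | g , Pg , start∈g , end∈g = g , Pg , subst (_∈ S g) start≡ start∈g , subst (_∈ S g) end≡ end∈g

  record PathIn (K : Subset q) (C : Subset n) (z y : Fin n) : Set where
    field
      walk    : Walk
      start≡  : start walk ≡ z
      end≡    : end walk ≡ y
      inner∈C : ∀ {m} → 0 < m → m ≤ len walk → vertex walk m ∈ C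
      edge∈K  : ∀ {m} → m < len walk → edge walk m ∈ K

  module _ {K : Subset q} {C : Subset n} {z : Fin n} where

    pathIn-single : ∀ {j y} → j ∈ K → z ∈ S j → y ∈ S j → y ∈ C → PathIn K C z y
    pathIn-single j∈K z∈j y∈j y∈C = record
      { walk = single _ z∈j y∈j ; start≡ = refl ; end≡ = refl
      ; inner∈C = λ { (s≤s z≤n) (s≤s z≤n) → y∈C } ; edge∈K = λ _ → j∈K }

    pathIn-extend : ∀ {c j y} → PathIn K C z c → j ∈ K → c ∈ S j → y ∈ S j → y ∈ C → PathIn K C z y
    pathIn-extend {c} {j} {y} p j∈K c∈j y∈j y∈C = record
      { walk = walk′ ; start≡ = start≡ ; end≡ = end′ ; inner∈C = inner∈C′ ; edge∈K = edge∈K′ }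
      where
        open PathIn p
        open Extend walk (subst (_∈ S j) (sym end≡) c∈j) y∈j
        inner∈C′ : ∀ {m} → 0 < m → m ≤ suc (len walk) → vertex′ m ∈ C
        inner∈C′ {m} 0<m m≤len′ with m≤n⇒m<n∨m≡n m≤len′
        ... | inj₁ (s≤s m≤len) = subst (_∈ C) (sym (old-vertex m≤len)) (inner∈C 0<m m≤len)
        ... | inj₂ refl        = subst (_∈ C) (sym end′) y∈C
        edge∈K′ : ∀ {m} → m < suc (len walk) → edge′ m ∈ K
        edge∈K′ m<len′ with new-or-old-edge m<len′
        ... | inj₁ eq           = subst (_∈ K) (sym eq) j∈K
        ... | inj₂ (m<len , eq) = subst (_∈ K) (sym eq) (edge∈K m<len)

    pathIn-mono : ∀ {C′ y} → C ⊆ C′ → PathIn K C z y → PathIn K C′ z y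
    pathIn-mono C⊆C′ p = record { PathIn p ; inner∈C = λ 0<m m≤len → C⊆C′ (inner∈C 0<m m≤len) }
      where open PathIn p

  Touches : Fin n → Subset n → Fin q → Set
  Touches z C j = z ∈ S j ⊎ ∃ λ c → c ∈ C × c ∈ S j

  touches? : ∀ z C j → Dec (Touches z C j)
  touches? z C j = z ∈? S j ⊎-dec any? λ c → c ∈? C ×-dec c ∈? S j

  record Component (R : Subset n) (K : Subset q) (D : Subset n) (z : Fin n) : Set where
    field
      C         : Subset n
      C⊆R─D     : C ⊆ R ─ D
      reachable : ∀ {y} → y ∈ C → PathIn K C z y
      closed    : ∀ {j y} → j ∈ K → Touches z C j → y ∈ R ─ D → y ∈ S j → y ∈ C

  opaque
    component : ∀ R K D z → Component R K D z
    component R K D z = grow ∅ (⊥-elim ∘ ∉⊥) (⊥-elim ∘ ∉⊥) (<-wellFounded _)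
      where
        Candidate : Subset n → Set
        Candidate C = ∃₂ λ j y → j ∈ K × Touches z C j × y ∈ R ─ D × y ∈ S j × y ∉ C
        candidate? : ∀ C → Dec (Candidate C)
        candidate? C = any? λ j → any? λ y →
          j ∈? K ×-dec touches? z C j ×-dec y ∈? R ─ D ×-dec y ∈? S j ×-dec ¬? (y ∈? C)
        grow : ∀ C → C ⊆ R ─ D → (∀ {y} → y ∈ C → PathIn K C z y) → Acc _<_ ∣ ∁ C ∣ → Component R K D z
        grow C C⊆R─D reachable (acc rec) with candidate? C
        ... | no none = record { C = C ; C⊆R─D = C⊆R─D ; reachable = reachable ; closed = closed }
          where
            closed : ∀ {j y} → j ∈ K → Touches z C j → y ∈ R ─ D → y ∈ S j → y ∈ C
            closed {j} {y} j∈K touch y∈R─D y∈j =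
              decidable-stable (y ∈? C) λ y∉C → none (j , y , j∈K , touch , y∈R─D , y∈j , y∉C)
        ... | yes (j , y , j∈K , touch , y∈R─D , y∈j , y∉C) =
          grow (C ∪ ⁅ y ⁆) C′⊆R─D reachable′ (rec (p⊂q⇒∣p∣<∣q∣ (p⊂q⇒∁p⊃∁q C⊂C′)))
          where
            C⊆C′ : C ⊆ C ∪ ⁅ y ⁆
            C⊆C′ = p⊆p∪q ⁅ y ⁆
            y∈C′ : y ∈ C ∪ ⁅ y ⁆
            y∈C′ = q⊆p∪q C ⁅ y ⁆ (x∈⁅x⁆ y)
            C⊂C′ : C ⊂ C ∪ ⁅ y ⁆
            C⊂C′ = C⊆C′ , y , y∈C′ , y∉C
            C′⊆R─D : C ∪ ⁅ y ⁆ ⊆ R ─ D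
            C′⊆R─D x∈C′ with x∈p∪⁅y⁆⁻ x∈C′
            ... | inj₁ x∈C = C⊆R─D x∈C
            ... | inj₂ refl = y∈R─D
            reachable′ : ∀ {x} → x ∈ C ∪ ⁅ y ⁆ → PathIn K (C ∪ ⁅ y ⁆) z x
            reachable′ x∈C′ with x∈p∪⁅y⁆⁻ x∈C′
            ... | inj₁ x∈C = pathIn-mono C⊆C′ (reachable x∈C)
            ... | inj₂ refl = case touch of λ where
              (inj₁ z∈j)             → pathIn-single j∈K z∈j y∈j y∈C′
              (inj₂ (c , c∈C , c∈j)) → pathIn-extend (pathIn-mono C⊆C′ (reachable c∈C)) j∈K c∈j y∈j y∈C′

  path-closing-edge : TotallyBalanced S → ∀ {K C d s c j t} → PathIn K C s c → (∀ {y} → y ∈ C → y ∉ S d) →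
                      j ∈ K → c ∈ S j → t ∈ S j → s ∈ S d → t ∈ S d → s ≢ t → ∃ λ g → g ∈ K × s ∈ S g × t ∈ S g
  path-closing-edge tb {K} {C} {d} {s} {c} {j} {t} p C∩d=∅ j∈K c∈j t∈j s∈d t∈d s≢t =
    let g , g∈K , s∈g , t∈g = excursion-edge d (_∈ K) tb walk′ excursion
    in  g , g∈K , subst (_∈ S g) start≡ s∈g , subst (_∈ S g) end′ t∈g
    where
      open PathIn p
      open Extend walk (subst (_∈ S j) (sym end≡) c∈j) t∈j
      excursion : Excursion d (_∈ K) walk′
      excursion = record
        { start∈d   = subst (_∈ S d) (sym start≡) s∈d
        ; end∈d     = subst (_∈ S d) (sym end′) t∈d
        ; start≢end = λ eq → s≢t (trans (sym start≡) (trans eq end′))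
        ; inner∉d   = λ 0<m m<len′ → subst (_∉ S d) (sym (old-vertex (s≤s⁻¹ m<len′)))
                                            (C∩d=∅ (inner∈C 0<m (s≤s⁻¹ m<len′)))
        ; edge-P    = λ m<len′ → case new-or-old-edge m<len′ of λ where
                        (inj₁ eq)           → subst (_∈ K) (sym eq) j∈K
                        (inj₂ (m<len , eq)) → subst (_∈ K) (sym eq) (edge∈K m<len)
        }

-- Nest points

module NestPoints {n q} {S : Family n q} (tb : TotallyBalanced S) where

  open Walks S

  -- The nest point must avoid the forbidden edge, if any; this strengthening drives the induction.
  forbidden : Maybe (Fin q) → Subset n
  forbidden nothing  = ∅
  forbidden (just e) = S e

  forbidden-edge : ∀ {D y} → y ∈ forbidden D → ∃ λ e → forbidden D ≡ S e
  forbidden-edge {nothing} y∈∅ = ⊥-elim (∉⊥ y∈∅)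
  forbidden-edge {just e}  _   = e , refl

  Problem : Set
  Problem = Subset n × Subset q × Maybe (Fin q)

  NestAvoiding : Problem → Set
  NestAvoiding (R , K , D) = ∀ {u} → u ∈ R → u ∉ forbidden D → ∃ λ x → x ∈ R × x ∉ forbidden D × Nest S R K x

  measure : Problem → ℕ × ℕ
  measure (R , K , D) = ∣ R ∣ + ∣ K ∣ , ∣ R ─ forbidden D ∣

  _⊏_ : Problem → Problem → Set
  _⊏_ = ×-Lex _≡_ _<_ _<_ on measure

  ⊏-wellFounded : WellFounded _⊏_
  ⊏-wellFounded = On.wellFounded measure (×-wellFounded <-wellFounded <-wellFounded)

  module Step (R : Subset n) (K : Subset q) (D : Maybe (Fin q))
              (rec : ∀ {p} → p ⊏ (R , K , D) → NestAvoiding p) where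

    Result : Set
    Result = ∃ λ x → x ∈ R × x ∉ forbidden D × Nest S R K x

    -- Unless C ∪ B and N exhaust R and K, the smaller problem (C ∪ B, N, D) has a nest point
    -- in C, and it is also one for R and K.
    module Around (z : Fin n) where

      open Component (component R K (forbidden D) z) public

      N? : ∀ j → Dec (j ∈ K × ∃ λ c → c ∈ C × c ∈ S j)
      N? j = j ∈? K ×-dec any? λ c → c ∈? C ×-dec c ∈? S j

      N : Subset q
      N = select N?

      B? : ∀ y → Dec (y ∈ R × y ∈ forbidden D × ∃ λ j → j ∈ N × y ∈ S j)
      B? y = y ∈? R ×-dec y ∈? forbidden D ×-dec any? λ j → j ∈? N ×-dec y ∈? S j

      B : Subset n
      B = select B?

      R′ : Subset n
      R′ = C ∪ B

      Spans : Set
      Spans = R ⊆ R′ × K ⊆ N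

      spans? : Dec Spans
      spans? = R ⊆? R′ ×-dec K ⊆? N

      C∩D=∅ : ∀ {y} → y ∈ C → y ∉ forbidden D
      C∩D=∅ = x∈p─q⇒x∉q ∘ C⊆R─D

      N⊆K : N ⊆ K
      N⊆K = proj₁ ∘ ∈-select⁻ N?

      meets-C : ∀ {j} → j ∈ N → ∃ λ c → c ∈ C × c ∈ S j
      meets-C = proj₂ ∘ ∈-select⁻ N?

      ∈N : ∀ {j c} → j ∈ K → c ∈ C → c ∈ S j → j ∈ N
      ∈N j∈K c∈C c∈j = ∈-select⁺ N? (j∈K , _ , c∈C , c∈j)

      B⊆D : ∀ {y} → y ∈ B → y ∈ forbidden D
      B⊆D = proj₁ ∘ proj₂ ∘ ∈-select⁻ B?

      on-N-edge : ∀ {y} → y ∈ B → ∃ λ j → j ∈ N × y ∈ S j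
      on-N-edge = proj₂ ∘ proj₂ ∘ ∈-select⁻ B?

      R′⊆R : R′ ⊆ R
      R′⊆R y∈R′ with x∈p∪q⁻ C B y∈R′
      ... | inj₁ y∈C = p─q⊆p R _ (C⊆R─D y∈C)
      ... | inj₂ y∈B = proj₁ (∈-select⁻ B? y∈B)

      ∈R′ : ∀ {y j} → y ∈ R → j ∈ N → y ∈ S j → y ∈ R′
      ∈R′ {y} {j} y∈R j∈N y∈j with y ∈? forbidden D
      ... | yes y∈D = q⊆p∪q C B (∈-select⁺ B? (y∈R , y∈D , j , j∈N , y∈j))
      ... | no  y∉D = p⊆p∪q B (closed (N⊆K j∈N) (inj₂ (meets-C j∈N)) (x∈p∧x∉q⇒x∈p─q y∈R y∉D) y∈j)

      R′∖D⊆C : ∀ {y} → y ∈ R′ → y ∉ forbidden D → y ∈ C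
      R′∖D⊆C y∈R′ y∉D with x∈p∪q⁻ C B y∈R′
      ... | inj₁ y∈C = y∈C
      ... | inj₂ y∈B = ⊥-elim (y∉D (B⊆D y∈B))

      lift : ∀ {x} → x ∈ C → Nest S R′ N x → Nest S R K x
      lift x∈C nest i∈K j∈K x∈i x∈j with nest (∈N i∈K x∈C x∈i) (∈N j∈K x∈C x∈j) x∈i x∈j
      ... | inj₁ i⊆j = inj₁ λ y∈R y∈i → i⊆j (∈R′ y∈R (∈N i∈K x∈C x∈i) y∈i) y∈i
      ... | inj₂ j⊆i = inj₂ λ y∈R y∈j → j⊆i (∈R′ y∈R (∈N j∈K x∈C x∈j) y∈j) y∈j

      via-component : ¬ Spans → ∀ {c} → c ∈ C → Result
      via-component ¬spans c∈C =
        let x , x∈R′ , x∉D , nest = rec {R′ , N , D} (inj₁ (∣∣+∣∣-mono-< R′⊆R N⊆K ¬spans))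
                                        (p⊆p∪q B c∈C) (C∩D=∅ c∈C)
            x∈C = R′∖D⊆C x∈R′ x∉D
        in x , R′⊆R x∈R′ , x∉D , lift x∈C nest

    -- Otherwise two vertices of B share an edge (a path through the component of one of them
    -- closes up to an excursion from the forbidden edge), so a single edge f covers B. If f contains
    -- R it is comparable with every edge and can be dropped; if not, it becomes the forbidden edge.
    module Spanning {u} (u∈R : u ∈ R) (u∉D : u ∉ forbidden D) {j₀} (j₀∈K : j₀ ∈ K) (spans : Around.Spans u) where

      open Around u

      linked : ∀ {s} → s ∈ B → ∃₂ λ g c → g ∈ K × s ∈ S g × c ∈ C × c ∈ S g
      linked s∈B = let g , g∈N , s∈g = on-N-edge s∈B ; c , c∈C , c∈g = meets-C g∈N
                   in g , c , N⊆K g∈N , s∈g , c∈C , c∈g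

      distinct-boundary-pair : ∀ {s₁ s₂} → s₁ ≢ s₂ → s₁ ∈ B → s₂ ∈ B → Result ⊎ ∃ λ g → g ∈ K × s₁ ∈ S g × s₂ ∈ S g
      distinct-boundary-pair {s₁} {s₂} s₁≢s₂ s₁∈B s₂∈B
        with linked s₁∈B | linked s₂∈B | forbidden-edge {D} (B⊆D s₁∈B) | Around.spans? s₁
      ... | g₁ , c₁ , g₁∈K , s₁∈g₁ , c₁∈C , c₁∈g₁ | _ | _ | no ¬spans₁ =
        inj₁ (Around.via-component s₁ ¬spans₁ (Around.closed s₁ g₁∈K (inj₁ s₁∈g₁) (C⊆R─D c₁∈C) c₁∈g₁))
      ... | _ | g₂ , c₂ , g₂∈K , s₂∈g₂ , c₂∈C , c₂∈g₂ | e , D≡e | yes (R⊆R′₁ , _) =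
        inj₂ (path-closing-edge tb (Around.reachable s₁ c₂∈C₁) C₁∩e=∅ g₂∈K c₂∈g₂ s₂∈g₂ (∈e s₁∈B) (∈e s₂∈B) s₁≢s₂)
        where
          c₂∈C₁ : c₂ ∈ Around.C s₁
          c₂∈C₁ = Around.R′∖D⊆C s₁ (R⊆R′₁ (R′⊆R (p⊆p∪q B c₂∈C))) (C∩D=∅ c₂∈C)
          C₁∩e=∅ : ∀ {y} → y ∈ Around.C s₁ → y ∉ S e
          C₁∩e=∅ y∈C₁ = Around.C∩D=∅ s₁ y∈C₁ ∘ subst (_ ∈_) (sym D≡e)
          ∈e : ∀ {y} → y ∈ B → y ∈ S e
          ∈e = subst (_ ∈_) D≡e ∘ B⊆D

      boundary-pair : ∀ {s₁ s₂} → s₁ ∈ B → s₂ ∈ B → Result ⊎ ∃ λ g → g ∈ K × s₁ ∈ S g × s₂ ∈ S g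
      boundary-pair {s₁} {s₂} s₁∈B s₂∈B with s₁ ≟ s₂
      ... | no  s₁≢s₂ = distinct-boundary-pair s₁≢s₂ s₁∈B s₂∈B
      ... | yes refl  = let g , _ , g∈K , s∈g , _ = linked s₁∈B in inj₂ (g , g∈K , s∈g , s∈g)

      boundary-cover : Result ⊎ ∃ λ f → f ∈ K × B ⊆ S f
      boundary-cover with pairs-or-escape B (λ a b → any? (λ g → g ∈? K ×-dec a ∈? S g ×-dec b ∈? S g))
                                          boundary-pair
      ... | inj₁ result = inj₁ result
      ... | inj₂ pairs  = inj₂ (conformal tb (j₀ , j₀∈K) B pairs)

      outside-cover : ∀ {f y} → B ⊆ S f → y ∈ R → y ∉ S f → y ∉ forbidden D
      outside-cover B⊆f y∈R y∉f y∈D with x∈p∪q⁻ C B (proj₁ spans y∈R)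
      ... | inj₁ y∈C = C∩D=∅ y∈C y∈D
      ... | inj₂ y∈B = y∉f (B⊆f y∈B)

      via-covering-edge : ∀ {f} → f ∈ K → R ⊆ S f → Result
      via-covering-edge {f} f∈K R⊆f =
        let x , x∈R , x∉D , nest = rec {R , K - f , D} (inj₁ (+-monoʳ-< ∣ R ∣ (x∈p⇒∣p-x∣<∣p∣ f∈K))) u∈R u∉D
        in x , x∈R , x∉D , nest-with-f nest
        where
          nest-with-f : ∀ {x} → Nest S R (K - f) x → Nest S R K x
          nest-with-f nest {i} {j} i∈K j∈K x∈i x∈j with i ≟ f | j ≟ f
          ... | yes refl | _        = inj₂ λ y∈R _ → R⊆f y∈R
          ... | no  _    | yes refl = inj₁ λ y∈R _ → R⊆f y∈R
          ... | no  i≢f  | no  j≢f  = nest (x∈p∧x≢y⇒x∈p-y i∈K i≢f) (x∈p∧x≢y⇒x∈p-y j∈K j≢f) x∈i x∈j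

      via-forbidden-edge : ∀ {f} → f ∈ K → B ⊆ S f → ¬ R ⊆ S f → Result
      via-forbidden-edge {f} f∈K B⊆f R⊈f =
        let u′ , u′∈R , u′∉f = ⊈⇒∃ R⊈f
            x , x∈R , x∉f , nest = rec {R , K , just f} (inj₂ (refl , p⊂q⇒∣p∣<∣q∣ R─f⊂R─D)) u′∈R u′∉f
        in x , x∈R , outside-cover B⊆f x∈R x∉f , nest
        where
          R─f⊆R─D : R ─ S f ⊆ R ─ forbidden D
          R─f⊆R─D y∈R─f = x∈p∧x∉q⇒x∈p─q (p─q⊆p R _ y∈R─f) (outside-cover B⊆f (p─q⊆p R _ y∈R─f) (x∈p─q⇒x∉q y∈R─f))
          R─f⊂R─D : R ─ S f ⊂ R ─ forbidden D
          R─f⊂R─D = let c , c∈C , c∈f = meets-C (proj₂ spans f∈K)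
                    in R─f⊆R─D , c , C⊆R─D c∈C , λ c∈R─f → x∈p─q⇒x∉q c∈R─f c∈f

      finish : Result
      finish with boundary-cover
      ... | inj₁ result = result
      ... | inj₂ (f , f∈K , B⊆f) with R ⊆? S f
      ...   | yes R⊆f = via-covering-edge f∈K R⊆f
      ...   | no  R⊈f = via-forbidden-edge f∈K B⊆f R⊈f

    result : NestAvoiding (R , K , D)
    result {u} u∈R u∉D with any? (λ j → j ∈? K ×-dec u ∈? S j)
    ... | no none = u , u∈R , u∉D , λ i∈K _ u∈i _ → ⊥-elim (none (_ , i∈K , u∈i))
    ... | yes (j₀ , j₀∈K , u∈j₀) with Around.spans? u
    ...   | yes spans  = Spanning.finish u∈R u∉D j₀∈K spans
    ...   | no  ¬spans =
      Around.via-component u ¬spans (Around.closed u j₀∈K (inj₁ u∈j₀) (x∈p∧x∉q⇒x∈p─q u∈R u∉D) u∈j₀)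

  nest-avoiding : ∀ p → NestAvoiding p
  nest-avoiding = All.wfRec ⊏-wellFounded _ NestAvoiding λ (R , K , D) rec → Step.result R K D (λ {p} → rec {p})

  nest-point : ∀ R K → Nonempty R → ∃ λ x → x ∈ R × Nest S R K x
  nest-point R K (u , u∈R) = let x , x∈R , _ , nest = nest-avoiding (R , K , nothing) u∈R ∉⊥ in x , x∈R , nest

-- Shelling orders

data Split (m k : ℕ) : Fin (m + k) → Set where
  left  : ∀ a → Split m k (a ↑ˡ k)
  right : ∀ b → Split m k (m ↑ʳ b)

split : ∀ m k i → Split m k i
split m k i with splitAt m i in eq
... | inj₁ a = subst (Split m k) (splitAt⁻¹-↑ˡ eq) (left a)
... | inj₂ b = subst (Split m k) (splitAt⁻¹-↑ʳ eq) (right b)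

ShellingOrder : ∀ {n} s → (Fin s → Subset n) → Set
ShellingOrder s F = ∀ (i j : Fin s) → i Fin.< j →
  ∃ λ v → (v ∈ F j ─ F i) × ∃ λ (ℓ : Fin s) → (ℓ Fin.< j) × (F j ─ F ℓ ≡ ⁅ v ⁆)

module _ {n : ℕ} where

  shellingOrder-join : ∀ {s} {F : Fin s → Subset n} {A} → (∀ i → Disjoint A (F i)) →
                       ShellingOrder s F → ShellingOrder s ((A ∪_) ∘ F)
  shellingOrder-join {F = F} A∩F=∅ order i j i<j =
    let v , v∈Fj─Fi , ℓ , ℓ<j , Fj─Fℓ≡v = order i j i<j
    in v , subst (v ∈_) (sym (p∪q─p∪r≡q─r (A∩F=∅ j))) v∈Fj─Fi , ℓ , ℓ<j , trans (p∪q─p∪r≡q─r (A∩F=∅ j)) Fj─Fℓ≡v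

  shellingOrder-++ : ∀ {s₁ s₂} {F : Fin s₁ → Subset n} {G : Fin s₂ → Subset n} →
                     ShellingOrder s₁ F → ShellingOrder s₂ G →
                     (∀ b a → ∃ λ v → v ∈ G b ─ F a × ∃ λ ℓ → G b ─ F ℓ ≡ ⁅ v ⁆) →
                     ShellingOrder (s₁ + s₂) (F ++ G)
  shellingOrder-++ {s₁} {s₂} {F} {G} orderF orderG cross i j i<j with split s₁ s₂ i | split s₁ s₂ j
  ... | left a | left a′
    rewrite lookup-++ˡ F G a | lookup-++ˡ F G a′ =
      let v , v∈ , ℓ , ℓ<a′ , eq = orderF a a′ (subst₂ _<_ (toℕ-↑ˡ a s₂) (toℕ-↑ˡ a′ s₂) i<j)
      in v , v∈ , ℓ ↑ˡ s₂ , subst₂ _<_ (sym (toℕ-↑ˡ ℓ s₂)) (sym (toℕ-↑ˡ a′ s₂)) ℓ<a′ ,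
         trans (cong (F a′ ─_) (lookup-++ˡ F G ℓ)) eq
  ... | right b | right b′
    rewrite lookup-++ʳ F G b | lookup-++ʳ F G b′ =
      let v , v∈ , ℓ , ℓ<b′ , eq = orderG b b′ (+-cancelˡ-< s₁ _ _ (subst₂ _<_ (toℕ-↑ʳ s₁ b) (toℕ-↑ʳ s₁ b′) i<j))
      in v , v∈ , s₁ ↑ʳ ℓ , subst₂ _<_ (sym (toℕ-↑ʳ s₁ ℓ)) (sym (toℕ-↑ʳ s₁ b′)) (+-monoʳ-< s₁ ℓ<b′) ,
         trans (cong (G b′ ─_) (lookup-++ʳ F G ℓ)) eq
  ... | left a | right b
    rewrite lookup-++ˡ F G a | lookup-++ʳ F G b =
      let v , v∈ , ℓ , eq = cross b a
      in v , v∈ , ℓ ↑ˡ s₂ , subst₂ _<_ (sym (toℕ-↑ˡ ℓ s₂)) (sym (toℕ-↑ʳ s₁ b)) (<-≤-trans (toℕ<n ℓ) (m≤m+n s₁ _)) ,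
         trans (cong (G b ─_) (lookup-++ˡ F G ℓ)) eq
  ... | right b | left a =
      ⊥-elim (<-irrefl refl (<-trans (subst₂ _<_ (toℕ-↑ʳ s₁ b) (toℕ-↑ˡ a s₂) i<j)
                                     (<-≤-trans (toℕ<n a) (m≤m+n s₁ _))))

  Enumerates : (Subset n → Set) → ∀ s → (Fin s → Subset n) → Set
  Enumerates P s F = Injective _≡_ _≡_ F × (∀ i → P (F i)) × (∀ G → P G → ∃ λ i → F i ≡ G)

  enumerates-image : ∀ {P P′ : Subset n → Set} {s} {F : Fin s → Subset n} (f : Subset n → Subset n) →
                     (∀ {X Y} → P X → P Y → f X ≡ f Y → X ≡ Y) → (∀ {X} → P X → P′ (f X)) →
                     (∀ {Y} → P′ Y → ∃ λ X → P X × f X ≡ Y) → Enumerates P s F → Enumerates P′ s (f ∘ F)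
  enumerates-image f f-injective f-into f-onto (injective , members , complete) =
    (injective ∘ f-injective (members _) (members _)) ,
    (f-into ∘ members) ,
    λ Y P′Y → let X , PX , fX≡Y = f-onto P′Y ; i , Fi≡X = complete X PX in i , trans (cong f Fi≡X) fX≡Y

  enumerates-++ : ∀ {P Q : Subset n → Set} {s₁ s₂} {F : Fin s₁ → Subset n} {G : Fin s₂ → Subset n} →
                  (∀ X → Dec (Q X)) → Enumerates (λ X → P X × Q X) s₁ F → Enumerates (λ X → P X × ¬ Q X) s₂ G →
                  Enumerates P (s₁ + s₂) (F ++ G)
  enumerates-++ {P} {Q} {s₁} {s₂} {F} {G} Q? (injF , memF , compF) (injG , memG , compG) =
    injective , members , complete
    where
      at-left : ∀ a → (F ++ G) (a ↑ˡ s₂) ≡ F a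
      at-left = lookup-++ˡ F G
      at-right : ∀ b → (F ++ G) (s₁ ↑ʳ b) ≡ G b
      at-right = lookup-++ʳ F G
      across : ∀ {a b} → F a ≢ G b
      across {a} {b} Fa≡Gb = proj₂ (memG b) (subst Q Fa≡Gb (proj₂ (memF a)))
      injective : Injective _≡_ _≡_ (F ++ G)
      injective {i} {j} eq with split s₁ s₂ i | split s₁ s₂ j
      ... | left a  | left a′  = cong (_↑ˡ s₂) (injF (trans (sym (at-left a)) (trans eq (at-left a′))))
      ... | right b | right b′ = cong (s₁ ↑ʳ_) (injG (trans (sym (at-right b)) (trans eq (at-right b′))))
      ... | left a  | right b  = ⊥-elim (across (trans (sym (at-left a)) (trans eq (at-right b))))
      ... | right b | left a   = ⊥-elim (across (trans (sym (at-left a)) (trans (sym eq) (at-right b))))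
      members : ∀ i → P ((F ++ G) i)
      members i with split s₁ s₂ i
      ... | left a  = subst P (sym (at-left a)) (proj₁ (memF a))
      ... | right b = subst P (sym (at-right b)) (proj₁ (memG b))
      complete : ∀ X → P X → ∃ λ i → (F ++ G) i ≡ X
      complete X PX with Q? X
      ... | yes QX = let a , Fa≡X = compF X (PX , QX) in a ↑ˡ s₂ , trans (at-left a) Fa≡X
      ... | no ¬QX = let b , Gb≡X = compG X (PX , ¬QX) in s₁ ↑ʳ b , trans (at-right b) Gb≡X

  ShellingOf : (Subset n → Set) → Set
  ShellingOf P = Σ ℕ λ s → Σ (Fin s → Subset n) λ F → Enumerates P s F × ShellingOrder s F

  shellingOf-none : ∀ {P : Subset n → Set} → (∀ X → ¬ P X) → ShellingOf P
  shellingOf-none ¬P = 0 , (λ ()) , ((λ {}) , (λ ()) , λ X PX → ⊥-elim (¬P X PX)) , λ ()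

  shellingOf-single : ∀ {P : Subset n → Set} {X} → P X → (∀ {Y} → P Y → Y ≡ X) → ShellingOf P
  shellingOf-single {X = X} PX unique =
    1 , (λ _ → X) , ((λ { {zero} {zero} _ → refl }) , (λ _ → PX) , λ Y PY → zero , sym (unique PY)) ,
    λ { zero zero () }

  shellingOf-++ : ∀ {P Q : Subset n → Set} → (∀ X → Dec (Q X)) →
                  (∀ {X Y} → P X × ¬ Q X → P Y × Q Y → ∃ λ v → v ∈ X ─ Y × ∃ λ Z → (P Z × Q Z) × X ─ Z ≡ ⁅ v ⁆) →
                  ShellingOf (λ X → P X × Q X) → ShellingOf (λ X → P X × ¬ Q X) → ShellingOf P
  shellingOf-++ Q? exchange (s₁ , F , enumF , orderF) (s₂ , G , enumG , orderG) =
    s₁ + s₂ , F ++ G , enumerates-++ Q? enumF enumG , shellingOrder-++ orderF orderG cross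
    where
      cross : ∀ b a → ∃ λ v → v ∈ G b ─ F a × ∃ λ ℓ → G b ─ F ℓ ≡ ⁅ v ⁆
      cross b a = let v , v∈ , Z , PQZ , eq = exchange (proj₁ (proj₂ enumG) b) (proj₁ (proj₂ enumF) a)
                      ℓ , Fℓ≡Z = proj₂ (proj₂ enumF) Z PQZ
                  in v , v∈ , ℓ , trans (cong (G b ─_) Fℓ≡Z) eq

-- Complexes of a family of edges

module Complex {n q : ℕ} where

  Face : Subset n → Family n q → Subset n → Set
  Face W E F = F ⊆ W × IsFace E F

  Facet : Subset n → Family n q → Subset n → Set
  Facet W E F = Face W E F × (∀ G → Face W E G → F ⊆ G → G ≡ F)

  face? : ∀ W E F → Dec (Face W E F)
  face? W E F = F ⊆? W ×-dec all? (λ j → ¬? (E j ⊆? F))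

  face-⊆ : ∀ {W E F G} → Face W E G → F ⊆ G → Face W E F
  face-⊆ (G⊆W , G-face) F⊆G = G⊆W ∘ F⊆G , λ j Ej⊆F → G-face j (F⊆G ∘ Ej⊆F)

  face⊆facet : ∀ {W E F} → Face W E F → ∃ λ G → Facet W E G × F ⊆ G
  face⊆facet {W} {E} {F} face = grow F face (<-wellFounded _)
    where
      grow : ∀ F → Face W E F → Acc _<_ ∣ ∁ F ∣ → ∃ λ G → Facet W E G × F ⊆ G
      grow F face (acc rec) with any? (λ y → ¬? (y ∈? F) ×-dec face? W E (F ∪ ⁅ y ⁆))
      ... | yes (y , y∉F , face′) =
        let G , facet , F′⊆G = grow (F ∪ ⁅ y ⁆) face′ (rec (p⊂q⇒∣p∣<∣q∣ (p⊂q⇒∁p⊃∁q F⊂F′)))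
        in G , facet , F′⊆G ∘ proj₁ F⊂F′
        where
          F⊂F′ : F ⊂ F ∪ ⁅ y ⁆
          F⊂F′ = p⊆p∪q ⁅ y ⁆ , y , q⊆p∪q F ⁅ y ⁆ (x∈⁅x⁆ y) , y∉F
      ... | no maximal = F , (face , λ G G-face F⊆G → ⊆-antisym (G⊆F G G-face F⊆G) F⊆G) , id
        where
          G⊆F : ∀ G → Face W E G → F ⊆ G → G ⊆ F
          G⊆F G G-face F⊆G {z} z∈G = decidable-stable (z ∈? F) λ z∉F →
            maximal (z , z∉F , face-⊆ G-face λ y∈F∪z → case x∈p∪⁅y⁆⁻ y∈F∪z of λ where
              (inj₁ y∈F) → F⊆G y∈F
              (inj₂ refl) → z∈G)

  module Minor (W : Subset n) (E : Family n q) {A B : Subset n} (A⊆B : A ⊆ B) (A⊆W : A ⊆ W)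
               (blocked : ∀ {H} → Face W E H → A ⊆ H → Disjoint (B ─ A) H) where

    W′ : Subset n
    W′ = W ─ B

    E′ : Family n q
    E′ j = E j ─ A

    A∩W′=∅ : ∀ {G} → G ⊆ W′ → Disjoint A G
    A∩W′=∅ G⊆W′ z∈A z∈G = x∈p─q⇒x∉q (G⊆W′ z∈G) (A⊆B z∈A)

    face-join : ∀ {G} → Face W′ E′ G → Face W E (A ∪ G)
    face-join {G} (G⊆W′ , G-face) = A∪G⊆W , λ j Ej⊆A∪G → G-face j λ {z} z∈Ej─A →
      case x∈p∪q⁻ A G (Ej⊆A∪G (p─q⊆p _ A z∈Ej─A)) of λ where
        (inj₁ z∈A) → ⊥-elim (x∈p─q⇒x∉q z∈Ej─A z∈A)
        (inj₂ z∈G) → z∈G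
      where
        A∪G⊆W : A ∪ G ⊆ W
        A∪G⊆W z∈A∪G = case x∈p∪q⁻ A G z∈A∪G of λ where
          (inj₁ z∈A) → A⊆W z∈A
          (inj₂ z∈G) → p─q⊆p W B (G⊆W′ z∈G)

    face-split : ∀ {H} → Face W E H → A ⊆ H → Face W′ E′ (H ─ A)
    face-split {H} H-face@(H⊆W , H-isFace) A⊆H = H─A⊆W′ , λ j Ej─A⊆H─A → H-isFace j λ {z} z∈Ej →
        case z ∈? A of λ where
          (yes z∈A) → A⊆H z∈A
          (no  z∉A) → p─q⊆p H A (Ej─A⊆H─A (x∈p∧x∉q⇒x∈p─q z∈Ej z∉A))
      where
        H─A⊆W′ : H ─ A ⊆ W′
        H─A⊆W′ z∈H─A = x∈p∧x∉q⇒x∈p─q (H⊆W (p─q⊆p H A z∈H─A)) λ z∈B →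
          blocked H-face A⊆H (x∈p∧x∉q⇒x∈p─q z∈B (x∈p─q⇒x∉q z∈H─A)) (p─q⊆p H A z∈H─A)

    facet-join : ∀ {G} → Facet W′ E′ G → Facet W E (A ∪ G)
    facet-join {G} (G-face , G-max) = face-join G-face , maximal
      where
        maximal : ∀ H → Face W E H → A ∪ G ⊆ H → H ≡ A ∪ G
        maximal H H-face A∪G⊆H =
          trans (sym (p⊆q⇒p∪[q─p]≡q A⊆H)) (cong (A ∪_) (G-max (H ─ A) (face-split H-face A⊆H) G⊆H─A))
          where
            A⊆H : A ⊆ H
            A⊆H = A∪G⊆H ∘ p⊆p∪q G
            G⊆H─A : G ⊆ H ─ A
            G⊆H─A z∈G = x∈p∧x∉q⇒x∈p─q (A∪G⊆H (q⊆p∪q A G z∈G)) λ z∈A → A∩W′=∅ (proj₁ G-face) z∈A z∈G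

    facet-split : ∀ {F} → Facet W E F → A ⊆ F → Facet W′ E′ (F ─ A)
    facet-split {F} (F-face , F-max) A⊆F = face-split F-face A⊆F , maximal
      where
        maximal : ∀ G → Face W′ E′ G → F ─ A ⊆ G → G ≡ F ─ A
        maximal G G-face F─A⊆G =
          trans (sym (p∪q─p≡q (A∩W′=∅ (proj₁ G-face)))) (cong (_─ A) (F-max (A ∪ G) (face-join G-face) F⊆A∪G))
          where
            F⊆A∪G : F ⊆ A ∪ G
            F⊆A∪G = subst (_⊆ A ∪ G) (p⊆q⇒p∪[q─p]≡q A⊆F) λ z∈ → case x∈p∪q⁻ A (F ─ A) z∈ of λ where
              (inj₁ z∈A)   → p⊆p∪q G z∈A
              (inj₂ z∈F─A) → q⊆p∪q A G (F─A⊆G z∈F─A)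

    joins : ∀ {Q : Subset n → Set} → (∀ {F} → Facet W E F → Q F → A ⊆ F) → (∀ {G} → Facet W′ E′ G → Q (A ∪ G)) →
            ShellingOf (Facet W′ E′) → ShellingOf (λ F → Facet W E F × Q F)
    joins {Q} Q⇒A⊆ join-Q (s , G , enumG@(_ , members , _) , orderG) =
      s , (A ∪_) ∘ G ,
      enumerates-image (A ∪_) injective (λ G-facet → facet-join G-facet , join-Q G-facet) onto enumG ,
      shellingOrder-join (λ i → A∩W′=∅ (proj₁ (proj₁ (members i)))) orderG
      where
        injective : ∀ {X Y} → Facet W′ E′ X → Facet W′ E′ Y → A ∪ X ≡ A ∪ Y → X ≡ Y
        injective ((X⊆W′ , _) , _) ((Y⊆W′ , _) , _) eq =
          trans (sym (p∪q─p≡q (A∩W′=∅ X⊆W′))) (trans (cong (_─ A) eq) (p∪q─p≡q (A∩W′=∅ Y⊆W′)))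
        onto : ∀ {F} → Facet W E F × Q F → ∃ λ X → Facet W′ E′ X × A ∪ X ≡ F
        onto (F-facet , QF) = _ , facet-split F-facet (Q⇒A⊆ F-facet QF) , p⊆q⇒p∪[q─p]≡q (Q⇒A⊆ F-facet QF)

    nestPoints : ∀ {K} → (∀ R → R ⊆ W → Nonempty R → ∃ λ x → x ∈ R × Nest E R K x) →
                 ∀ R → R ⊆ W′ → Nonempty R → ∃ λ x → x ∈ R × Nest E′ R K x
    nestPoints nests R R⊆W′ R≠∅ =
      let x , x∈R , nest = nests R (p─q⊆p W B ∘ R⊆W′) R≠∅
      in x , x∈R , λ i∈K j∈K x∈i′ x∈j′ →
           Sum.map ⊆[]-─ ⊆[]-─ (nest i∈K j∈K (p─q⊆p _ A x∈i′) (p─q⊆p _ A x∈j′))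

  module Link (W : Subset n) (E : Family n q) {x} (x∈W : x ∈ W) where

    open Minor W E {⁅ x ⁆} id (x∈p⇒⁅x⁆⊆p x∈W) (λ _ _ z∈∅ _ → x∈p─q⇒x∉q z∈∅ (p─q⊆p _ _ z∈∅)) public

    facets∋x : ShellingOf (Facet (W - x) (λ j → E j - x)) → ShellingOf (λ F → Facet W E F × x ∈ F)
    facets∋x = joins (λ _ → x∈p⇒⁅x⁆⊆p) (λ _ → p⊆p∪q _ (x∈⁅x⁆ x))

  F∪⁅x⁆⊆W : ∀ {W F : Subset n} {x} → F ⊆ W → x ∈ W → F ∪ ⁅ x ⁆ ⊆ W
  F∪⁅x⁆⊆W F⊆W x∈W y∈ = case x∈p∪⁅y⁆⁻ y∈ of λ where
    (inj₁ y∈F) → F⊆W y∈F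
    (inj₂ refl) → x∈W

  facet-blocks : ∀ {W E F x} → Facet W E F → x ∈ W → x ∉ F → ∃ λ k → E k ⊆ F ∪ ⁅ x ⁆ × x ∈ E k
  facet-blocks {W} {E} {F} {x} ((F⊆W , F-face) , F-max) x∈W x∉F
    with any? (λ k → E k ⊆? F ∪ ⁅ x ⁆)
  ... | yes (k , Ek⊆F∪x) = k , Ek⊆F∪x , decidable-stable (x ∈? E k) λ x∉Ek → F-face k λ {y} y∈Ek →
          case x∈p∪⁅y⁆⁻ (Ek⊆F∪x y∈Ek) of λ where
            (inj₁ y∈F) → y∈F
            (inj₂ refl) → ⊥-elim (x∉Ek y∈Ek)
  ... | no ¬blocked =
    ⊥-elim (x∉F (subst (x ∈_) (F-max (F ∪ ⁅ x ⁆) F∪x-face (p⊆p∪q ⁅ x ⁆)) (q⊆p∪q F ⁅ x ⁆ (x∈⁅x⁆ x))))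
    where
      F∪x-face : Face W E (F ∪ ⁅ x ⁆)
      F∪x-face = F∪⁅x⁆⊆W F⊆W x∈W , λ k Ek⊆F∪x → ¬blocked (k , Ek⊆F∪x)

  facet∋x : ∀ {W E F x} → x ∈ W → (∀ {j} → E j ⊆ W → x ∉ E j) → Facet W E F → x ∈ F
  facet∋x {W} {E} {F} {x} x∈W x∉edges F-facet@((F⊆W , _) , _) = decidable-stable (x ∈? F) λ x∉F →
    let k , Ek⊆F∪x , x∈Ek = facet-blocks F-facet x∈W x∉F
    in x∉edges (F∪⁅x⁆⊆W F⊆W x∈W ∘ Ek⊆F∪x) x∈Ek

  module MinimalEdge (W : Subset n) (E : Family n q) {x e} (x∈e : x ∈ E e) (e⊆W : E e ⊆ W)
                     (minimal : ∀ {j} → E j ⊆ W → x ∈ E j → E e ⊆ E j) where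

    A : Subset n
    A = E e - x

    x∈W : x ∈ W
    x∈W = e⊆W x∈e

    e⊆A∪x : ∀ {H y} → A ⊆ H → y ∈ E e → y ∉ H → y ≡ x
    e⊆A∪x A⊆H y∈e y∉H = decidable-stable (_ ≟ x) λ y≢x → y∉H (A⊆H (x∈p∧x≢y⇒x∈p-y y∈e y≢x))

    x∉face⊇A : ∀ {H} → Face W E H → A ⊆ H → x ∉ H
    x∉face⊇A {H} (_ , H-face) A⊆H x∈H =
      H-face e λ {y} y∈e → decidable-stable (y ∈? H) λ y∉H → y∉H (subst (_∈ H) (sym (e⊆A∪x A⊆H y∈e y∉H)) x∈H)

    open Minor W E {A} {E e} (p─q⊆p _ _) (e⊆W ∘ p─q⊆p _ _)
               (λ H-face A⊆H z∈e─A z∈H → x∉face⊇A H-face A⊆H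
                 (subst (_∈ _) (e⊆A∪x id (p─q⊆p _ _ z∈e─A) (x∈p─q⇒x∉q z∈e─A)) z∈H)) public

    A⊆facet∌x : ∀ {F} → Facet W E F → x ∉ F → A ⊆ F
    A⊆facet∌x {F} F-facet@((F⊆W , _) , _) x∉F {y} y∈A with facet-blocks F-facet x∈W x∉F
    ... | k , Ek⊆F∪x , x∈Ek with x∈p∪⁅y⁆⁻ (Ek⊆F∪x (minimal (F∪⁅x⁆⊆W F⊆W x∈W ∘ Ek⊆F∪x) x∈Ek (p─q⊆p _ _ y∈A)))
    ...   | inj₁ y∈F = y∈F
    ...   | inj₂ refl = ⊥-elim (x∈p-y⇒x≢y y∈A refl)

    facets∌x : ShellingOf (Facet (W ─ E e) (λ j → E j ─ A)) → ShellingOf (λ F → Facet W E F × x ∉ F)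
    facets∌x = joins A⊆facet∌x λ G-facet x∈A∪G → case x∈p∪q⁻ A _ x∈A∪G of λ where
      (inj₁ x∈A) → x∈p-y⇒x≢y x∈A refl
      (inj₂ x∈G) → x∈p─q⇒x∉q (proj₁ (proj₁ G-facet) x∈G) x∈e

    exchange : ∀ {X Y} → Facet W E X × x ∉ X → Facet W E Y × x ∈ Y →
               ∃ λ v → v ∈ X ─ Y × ∃ λ Z → (Facet W E Z × x ∈ Z) × X ─ Z ≡ ⁅ v ⁆
    exchange {X} {Y} (X-facet@((X⊆W , X-face) , _) , x∉X) (((_ , Y-face) , _) , x∈Y)
      with ⊈⇒∃ (Y-face e)
    ... | v , v∈e , v∉Y = v , x∈p∧x∉q⇒x∈p─q v∈X v∉Y , Z , (Z-facet , x∈Z) , ⊆-antisym X─Z⊆v v⊆X─Z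
      where
        v≢x : v ≢ x
        v≢x refl = v∉Y x∈Y
        v∈X : v ∈ X
        v∈X = A⊆facet∌x X-facet x∉X (x∈p∧x≢y⇒x∈p-y v∈e v≢x)
        -- Z extends P; it misses v because E e ⊆ P ∪ ⁅ v ⁆.
        P : Subset n
        P = (X - v) ∪ ⁅ x ⁆
        X-v⊆P : X - v ⊆ P
        X-v⊆P = p⊆p∪q ⁅ x ⁆
        P-face : Face W E P
        P-face = F∪⁅x⁆⊆W (X⊆W ∘ p─q⊆p X _) x∈W , λ k Ek⊆P → case x ∈? E k of λ where
          (yes x∈Ek) → case x∈p∪⁅y⁆⁻ (Ek⊆P (minimal (F∪⁅x⁆⊆W (X⊆W ∘ p─q⊆p X _) x∈W ∘ Ek⊆P) x∈Ek v∈e)) of λ where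
            (inj₁ v∈X-v) → x∈p-y⇒x≢y v∈X-v refl
            (inj₂ v≡x)   → v≢x v≡x
          (no x∉Ek) → X-face k λ {y} y∈Ek → case x∈p∪⁅y⁆⁻ (Ek⊆P y∈Ek) of λ where
            (inj₁ y∈X-v) → p─q⊆p X _ y∈X-v
            (inj₂ refl)  → ⊥-elim (x∉Ek y∈Ek)
        Z-data = face⊆facet P-face
        Z = proj₁ Z-data
        Z-facet = proj₁ (proj₂ Z-data)
        P⊆Z : P ⊆ Z
        P⊆Z = proj₂ (proj₂ Z-data)
        x∈Z : x ∈ Z
        x∈Z = P⊆Z (q⊆p∪q (X - v) ⁅ x ⁆ (x∈⁅x⁆ x))
        v∉Z : v ∉ Z
        v∉Z v∈Z = proj₂ (proj₁ Z-facet) e λ {y} y∈e → case y ≟ v of λ where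
          (yes refl) → v∈Z
          (no  y≢v)  → case y ≟ x of λ where
            (yes refl) → x∈Z
            (no  y≢x)  → P⊆Z (X-v⊆P (x∈p∧x≢y⇒x∈p-y (A⊆facet∌x X-facet x∉X (x∈p∧x≢y⇒x∈p-y y∈e y≢x)) y≢v))
        X─Z⊆v : X ─ Z ⊆ ⁅ v ⁆
        X─Z⊆v {y} y∈X─Z = case y ≟ v of λ where
          (yes refl) → x∈⁅x⁆ v
          (no  y≢v)  → ⊥-elim (x∈p─q⇒x∉q y∈X─Z (P⊆Z (X-v⊆P (x∈p∧x≢y⇒x∈p-y (p─q⊆p X Z y∈X─Z) y≢v))))
        v⊆X─Z : ⁅ v ⁆ ⊆ X ─ Z
        v⊆X─Z = x∈p⇒⁅x⁆⊆p (x∈p∧x∉q⇒x∈p─q v∈X v∉Z)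

  ⊂-minimal : ∀ (E : Family n q) {P : Fin q → Set} → (∀ j → Dec (P j)) →
              ∀ {j} → P j → ∃ λ e → P e × ∀ {k} → P k → ¬ E k ⊂ E e
  ⊂-minimal E {P} P? {j} Pj = descend j Pj (<-wellFounded ∣ E j ∣)
    where
      descend : ∀ j → P j → Acc _<_ ∣ E j ∣ → ∃ λ e → P e × ∀ {k} → P k → ¬ E k ⊂ E e
      descend j Pj (acc rec) with any? (λ k → P? k ×-dec E k ⊂? E j)
      ... | yes (k , Pk , k⊂j) = descend k Pk (rec (p⊂q⇒∣p∣<∣q∣ k⊂j))
      ... | no  none           = j , Pj , λ Pk k⊂j → none (_ , Pk , k⊂j)

  chain-minimum : ∀ (E : Family n q) {P : Fin q → Set} → (∀ j → Dec (P j)) →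
                  (∀ {i j} → P i → P j → E i ⊆ E j ⊎ E j ⊆ E i) →
                  ∀ {j} → P j → ∃ λ e → P e × ∀ {k} → P k → E e ⊆ E k
  chain-minimum E P? chain Pj =
    let e , Pe , ⊂-min = ⊂-minimal E P? Pj
    in e , Pe , λ {k} Pk → case chain Pe Pk of λ where
         (inj₁ e⊆k) → e⊆k
         (inj₂ k⊆e) → decidable-stable (E e ⊆? E k) λ e⊈k → ⊂-min Pk (⊆∧⊈⇒⊂ k⊆e e⊈k)

  NestPointsIn : Subset n → Family n q → Set
  NestPointsIn W E = ∀ K R → R ⊆ W → Nonempty R → ∃ λ x → x ∈ R × Nest E R K x

  edgesIn : Subset n → Family n q → Subset q
  edgesIn W E = select λ j → E j ⊆? W

  nest⇒chain : ∀ {W E x} → Nest E W (edgesIn W E) x →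
               ∀ {i k} → E i ⊆ W × x ∈ E i → E k ⊆ W × x ∈ E k → E i ⊆ E k ⊎ E k ⊆ E i
  nest⇒chain {W} {E} nest (Ei⊆W , x∈Ei) (Ek⊆W , x∈Ek) =
    Sum.map (λ i⊆k y∈Ei → i⊆k (Ei⊆W y∈Ei) y∈Ei) (λ k⊆i y∈Ek → k⊆i (Ek⊆W y∈Ek) y∈Ek)
            (nest (∈-select⁺ (λ j → E j ⊆? W) Ei⊆W) (∈-select⁺ (λ j → E j ⊆? W) Ek⊆W) x∈Ei x∈Ek)

  shellable-empty : ∀ {W E} → Empty W → ShellingOf (Facet W E)
  shellable-empty {W} {E} W-empty with face? W E ∅
  ... | yes ∅-face =
    shellingOf-single (∅-face , λ { G (G⊆W , _) _ → ⊆W⇒≡∅ G⊆W }) λ { ((F⊆W , _) , _) → ⊆W⇒≡∅ F⊆W }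
    where
      ⊆W⇒≡∅ : ∀ {F} → F ⊆ W → F ≡ ∅
      ⊆W⇒≡∅ F⊆W = ⊆-antisym (λ z∈F → ⊥-elim (W-empty (_ , F⊆W z∈F))) ⊥⊆
  ... | no ¬∅-face = shellingOf-none λ { F ((F-face , _)) → ¬∅-face (face-⊆ F-face ⊥⊆) }

  module Decomposition (W : Subset n) (E : Family n q) (nests : NestPointsIn W E)
                       (shellable′ : ∀ {W′} → ∣ W′ ∣ < ∣ W ∣ → ∀ E′ → NestPointsIn W′ E′ → ShellingOf (Facet W′ E′)) where

    facets∋ : ∀ {x} → x ∈ W → ShellingOf (λ F → Facet W E F × x ∈ F)
    facets∋ x∈W = Link.facets∋x W E x∈W
      (shellable′ (x∈p⇒∣p-x∣<∣p∣ x∈W) _ λ K → Link.nestPoints W E x∈W (nests K))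

    at-nest-point : ∀ {x} → x ∈ W → Nest E W (edgesIn W E) x → ShellingOf (Facet W E)
    at-nest-point {x} x∈W nest with any? (λ j → E j ⊆? W ×-dec x ∈? E j)
    ... | no none = shellingOf-++ (x ∈?_) (λ (X-facet , x∉X) _ → ⊥-elim (x∉X (facet∋x′ X-facet)))
                      (facets∋ x∈W) (shellingOf-none λ F (F-facet , x∉F) → x∉F (facet∋x′ F-facet))
      where
        facet∋x′ : ∀ {F} → Facet W E F → x ∈ F
        facet∋x′ = facet∋x x∈W λ Ej⊆W x∈Ej → none (_ , Ej⊆W , x∈Ej)
    ... | yes (j , through-x) =
      let e , (e⊆W , x∈e) , minimal =
            chain-minimum E (λ k → E k ⊆? W ×-dec x ∈? E k) (nest⇒chain nest) through-x
          module M = MinimalEdge W E x∈e e⊆W (λ Ek⊆W x∈Ek → minimal (Ek⊆W , x∈Ek))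
          W─e-smaller = p∩q≢∅⇒∣p─q∣<∣p∣ W (E e) (x , x∈p∩q⁺ (x∈W , x∈e))
      in shellingOf-++ (x ∈?_) M.exchange (facets∋ x∈W)
           (M.facets∌x (shellable′ W─e-smaller _ λ K → M.nestPoints (nests K)))

  shellable : ∀ W E → NestPointsIn W E → ShellingOf (Facet W E)
  shellable = All.wfRec (On.wellFounded ∣_∣ <-wellFounded) _
    (λ W → ∀ E → NestPointsIn W E → ShellingOf (Facet W E))
    λ W shellable′ E nests → case nonempty? W of λ where
      (no  W-empty) → shellable-empty W-empty
      (yes W≠∅)     → let x , x∈W , nest = nests (edgesIn W E) W id W≠∅
                      in Decomposition.at-nest-point W E nests shellable′ x∈W nest

open Complex

corollary5p4 : ∀ (n q : ℕ) (S : Family n q) →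
    IsClutter S → TotallyBalanced S → Shellable S
corollary5p4 n q S _ tb =
  let s , F , (injective , facets , complete) , order = shellable ⊤ S nestPoints
  in  s , F , injective , (λ i → isFacet (facets i)) , (λ G G-facet → complete G (fromIsFacet G-facet)) , order
  where
    nestPoints : NestPointsIn ⊤ S
    nestPoints K R _ = NestPoints.nest-point tb R K
    isFacet : ∀ {F} → Facet ⊤ S F → IsFacet S F
    isFacet ((_ , F-face) , F-max) = F-face , λ G G-face → F-max G (⊆⊤ , G-face)
    fromIsFacet : ∀ {F} → IsFacet S F → Facet ⊤ S F
    fromIsFacet (F-face , F-max) = (⊆⊤ , F-face) , λ G (_ , G-face) → F-max G G-face
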